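{- Let $n,T\in\mathbb{N}$ and $A\subseteq[n]^2$ such that $|\{v\in[n]:(u,v)\in A\}|=T$ for every $u\in[n]$. Let $\Gamma=\Gamma(A)$ and $\Gamma_\uparrow=\Gamma_\uparrow(A)$ be the gates described in the context. Then for every $x\in\{0,1\}^{4n}$ satisfying $\varphi_{one}(x)$, $$\mathrm{Sig}(\Gamma_\uparrow,x)-\mathrm{Sig}(\Gamma,x)=\begin{cases}0 & \text{if }\neg\varphi_{prop}(x),\\ n-2T-2 & \text{if }\varphi_{prop}(x)\text{ and }(x_W,x_N)\notin A,\\ n-2T+2 & \text{if }\varphi_{prop}(x)\text{ and }(x_W,x_N)\in A.\end{cases}$$
   Context: Notation: $\mathrm{hw}(z)$ = number of ones of $z$; $\mathrm{HW}_{=1}(z)=[\mathrm{hw}(z)=1]$. Signatures on $\{0,1\}^4$ (bits ordered north, east, south, west): $\mathrm{PASS}(y)=-1$ if $y=1111$; $=1$ if $y\in\{0000,0101,1010\}$; $=0$ otherwise. On $\{0,1\}^6$, writing $x=yab$ with $y\in\{0,1\}^4$: $\mathrm{PRE}(x)=\mathrm{PASS}(y)$ if $ab=00$; $=1$ if $x\in\{101011,111111,100001,110101,001010,011110\}$; $=0$ otherwise. A gate is an edge-weighted multigraph with vertex functions $f_v:\{0,1\}^{I(v)}\to\mathbb{C}$ ($I(v)$ = incident edges in a specified order) and a set $D$ of dangling edges (one endpoint, weight $1$); $\mathrm{Sig}(\Gamma,x)=\sum_{y\in\{0,1\}^{E\setminus D}}\prod_{e:(xy)(e)=1}w(e)\prod_v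 f_v((xy)|_{I(v)})$ for $x\in\{0,1\}^D$. $\Gamma(A)$: vertices $b_{i,j}$, $i,j\in[n]$ ($i$ row from top, $j$ column); for $i<n$ an edge joins $b_{i,j}$ (its south edge) and $b_{i+1,j}$ (its north edge); for $j<n$ an edge joins $b_{i,j}$ (east) and $b_{i,j+1}$ (west); dangling edges: north of $b_{1,j}$, south of $b_{n,j}$, west of $b_{i,1}$, east of $b_{i,n}$; the first four edges of each $b_{i,j}$ are ordered north, east, south, west. Two apex vertices $a_1,a_2$ with function $\mathrm{HW}_{=1}$. For $\tau\in A$, $b_\tau$ has function $\mathrm{PRE}$ with 5th edge $a_1b_\tau$ and 6th edge $a_2b_\tau$; every other $b_\tau$ has $\mathrm{PASS}$. All edge weights $1$. $\Gamma_\uparrow(A)$: obtained from $\Gamma(A)$ by adding a dummy row above row $1$ and one below row $n$: new vertices $b_{0,j}$ and $b_{n+1,j}$ ($j\in[n]$), each with four edges (north, south, to $a_1$, to $a_2$) and vertex function $(z_1,z_3,z_5,z_6)\mapsto\mathrm{PRE}(z_1\,0\,z_3\,0\,z_5\,z_6)$ (i.e. a $\mathrm{PRE}$ vertex whose west and east edges are forced inactive); edges join $b_{0,j}$ (south) with $b_{1,j}$ (north) and $b_{n,j}$ (south) with $b_{n+1,j}$ (north), and each $b_{0,j},b_{n+1,j}$ is joined to $a_1$ and $a_2$. The north dangling edges are now those of $b_{0,j}$ and the south dangling edges those of $b_{n+1,j}$. In both gates, an assignment to the dangling edges is $x=x_Nx_Ex_Sx_W\in\{0,1\}^{4n}$,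 with $x_N(j)$ the north dangling edge in column $j$, $x_S(j)$ the south dangling edge in column $j$, $x_W(i)$ the west dangling edge of $b_{i,1}$, $x_E(i)$ the east dangling edge of $b_{i,n}$; strings $0^{v-1}10^{n-v}$ are identified with $v\in[n]$. $\varphi_{one}(x)$: $\mathrm{hw}(x_N)=\mathrm{hw}(x_W)=1$; $\varphi_{prop}(x)$: $x_N=x_S$ and $x_W=x_E$. -}

module Defs where

open import Data.Bool using (Bool; true; false; if_then_else_)
open import Data.Nat as ℕ using (ℕ; zero; suc; _∸_)
open import Data.Integer as ℤ using (ℤ; +_; -[1+_]; _+_; _*_)
open import Data.Fin using (Fin; zero; suc; inject₁; fromℕ; splitAt; _≟_)
open import Data.Fin.Properties using (+↔⊎; *↔×)
open import Data.Product using (Σ; _×_; _,_; proj₁; proj₂)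
open import Data.Product.Properties using (≡-dec)
open import Data.Product.Function.NonDependent.Propositional using (_×-↔_)
open import Data.Sum using (_⊎_; inj₁; inj₂; [_,_])
open import Data.Sum.Function.Propositional using (_⊎-↔_)
open import Data.List using (List; length)
open import Data.List.Membership.Propositional using (_∈_)
open import Data.List.Relation.Unary.Any using (index)
import Data.List.Membership.DecPropositional as DecMem
open import Data.Maybe using (Maybe; just; nothing)
open import Function using (_∘_)
open import Function.Bundles using (_↔_; Inverse)
open import Function.Properties.Inverse using (↔-refl; ↔-trans)
open import Relation.Nullary using (Dec; yes; no; ⌊_⌋)
open import Relation.Binary.PropositionalEquality using (_≡_)

∑ : (k : ℕ) → (Fin k → ℤ) → ℤ
∑ zero    f = + 0
∑ (suc k) f = f zero + ∑ k (f ∘ suc)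

∏ : (k : ℕ) → (Fin k → ℤ) → ℤ
∏ zero    f = + 1
∏ (suc k) f = f zero * ∏ k (f ∘ suc)

_◂_ : ∀ {k} → Bool → (Fin k → Bool) → Fin (suc k) → Bool
(b ◂ y) zero    = b
(b ◂ y) (suc i) = y i

∑Bits : (k : ℕ) → ((Fin k → Bool) → ℤ) → ℤ
∑Bits zero    F = F (λ ())
∑Bits (suc k) F = ∑Bits k (λ y → F (false ◂ y)) + ∑Bits k (λ y → F (true ◂ y))

hw : ∀ {k} → (Fin k → Bool) → ℕ
hw {zero}  z = 0
hw {suc k} z = (if z zero then 1 else 0) ℕ.+ hw (z ∘ suc)

-- the string 0^{v-1} 1 0^{n-v}, identified with v ∈ [n]
unit : ∀ {n} → Fin n → Fin n → Bool
unit v j = ⌊ j ≟ v ⌋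

record FinSet : Set₁ where
  field
    El   : Set
    size : ℕ
    enum : Fin size ↔ El

open FinSet public

finˢ : ℕ → FinSet
finˢ k = record { El = Fin k ; size = k ; enum = ↔-refl }

_⊎ˢ_ : FinSet → FinSet → FinSet
S ⊎ˢ T = record { El = El S ⊎ El T ; size = size S ℕ.+ size T
                ; enum = ↔-trans +↔⊎ (enum S ⊎-↔ enum T) }

_×ˢ_ : FinSet → FinSet → FinSet
S ×ˢ T = record { El = El S × El T ; size = size S ℕ.* size T
                ; enum = ↔-trans *↔× (enum S ×-↔ enum T) }

infixr 4 _⊎ˢ_
infixr 5 _×ˢ_

record VertexData (Edge : Set) : Set where
  field
    deg : ℕ
    inc : Fin deg → Edge
    fun : (Fin deg → Bool) → ℤ

record Gate : Set₁ where
  field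
    V    : FinSet
    E    : FinSet                        -- non-dangling edges  (E \ D)
    D    : Set                           -- dangling edges (weight 1)
    w    : El E → ℤ
    vert : El V → VertexData (El E ⊎ D)

-- Sig(Γ,x) = Σ_{y ∈ {0,1}^{E\D}} Π_{e:(xy)(e)=1} w(e) Π_v f_v((xy)|_{I(v)})
Sig : (Γ : Gate) → (Gate.D Γ → Bool) → ℤ
Sig Γ x =
  ∑Bits (size E) λ y′ →
    let y : El E → Bool
        y = y′ ∘ Inverse.from (enum E)
        xy : El E ⊎ D → Bool
        xy = [ y , x ]
    in ∏ (size E) (λ k → if y′ k then w (Inverse.to (enum E) k) else + 1)
     * ∏ (size V) (λ k → let open VertexData (vert (Inverse.to (enum V) k))
                         in fun (xy ∘ inc))
  where open Gate Γ

-- PASS on (north, east, south, west)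
pass : Bool → Bool → Bool → Bool → ℤ
pass true  true  true  true  = -[1+ 0 ]
pass false false false false = + 1
pass false true  false true  = + 1
pass true  false true  false = + 1
pass _     _     _     _     = + 0

-- PRE on y a b with y = (north, east, south, west)
pre : Bool → Bool → Bool → Bool → Bool → Bool → ℤ
pre n e s w false false = pass n e s w
pre true  false true  false true  true  = + 1
pre true  true  true  true  true  true  = + 1
pre true  false false false false true  = + 1
pre true  true  false true  false true  = + 1
pre false false true  false true  false = + 1
pre false true  true  true  true  false = + 1
pre _ _ _ _ _ _ = + 0

PASS : (Fin 4 → Bool) → ℤ
PASS z = pass (z zero) (z (suc zero)) (z (suc (suc zero))) (z (suc (suc (suc zero))))

PRE : (Fin 6 → Bool) → ℤ
PRE z = pre (z zero) (z (suc zero)) (z (suc (suc zero))) (z (suc (suc (suc zero))))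
            (z (suc (suc (suc (suc zero))))) (z (suc (suc (suc (suc (suc zero))))))

-- dummy-row vertex: edges (north, south, a₁, a₂), z ↦ PRE(z₁ 0 z₃ 0 z₅ z₆)
PREdummy : (Fin 4 → Bool) → ℤ
PREdummy z = pre (z zero) false (z (suc zero)) false
                 (z (suc (suc zero))) (z (suc (suc (suc zero))))

HW=1 : ∀ {k} → (Fin k → Bool) → ℤ
HW=1 z with hw z
... | 1 = + 1
... | _ = + 0

edges4 : ∀ {X : Set} → X → X → X → X → Fin 4 → X
edges4 a b c d zero = a
edges4 a b c d (suc zero) = b
edges4 a b c d (suc (suc zero)) = c
edges4 a b c d (suc (suc (suc zero))) = d

edges6 : ∀ {X : Set} → X → X → X → X → X → X → Fin 6 → X
edges6 a b c d e f zero = a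
edges6 a b c d e f (suc zero) = b
edges6 a b c d e f (suc (suc zero)) = c
edges6 a b c d e f (suc (suc (suc zero))) = d
edges6 a b c d e f (suc (suc (suc (suc zero)))) = e
edges6 a b c d e f (suc (suc (suc (suc (suc zero))))) = f

-- Grid helpers.  An edge index k : Fin m between consecutive positions
-- of Fin (suc m) joins position (inject₁ k) and position (suc k).

before : ∀ {n} → Fin n → Maybe (Fin (n ∸ 1))
before {suc m} zero    = nothing
before {suc m} (suc i) = just i

after′ : ∀ {m} → Fin (suc m) → Maybe (Fin m)
after′ {zero}  zero    = nothing
after′ {suc m} zero    = just zero
after′ {suc m} (suc i) with after′ {m} i
... | just k  = just (suc k)
... | nothing = nothing

after : ∀ {n} → Fin n → Maybe (Fin (n ∸ 1))
after {suc m} i = after′ i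

data Dir : Set where
  north east south west : Dir

assemble : ∀ {n} → (xN xE xS xW : Fin n → Bool) → Dir × Fin n → Bool
assemble xN xE xS xW (north , j) = xN j
assemble xN xE xS xW (east  , i) = xE i
assemble xN xE xS xW (south , j) = xS j
assemble xN xE xS xW (west  , i) = xW i

-- A ⊆ [n]², represented as a list of pairs (row, column)
Pairs : ℕ → Set
Pairs n = List (Fin n × Fin n)

_∈?_ : ∀ {n} (τ : Fin n × Fin n) (A : Pairs n) → Dec (τ ∈ A)
_∈?_ {n} = DecMem._∈?_ (≡-dec _≟_ _≟_)

module GammaDef (n : ℕ) (A : Pairs n) where
  L = length A

  Vs : FinSet
  Vs = (finˢ n ×ˢ finˢ n) ⊎ˢ finˢ 2          -- b_{i,j} ; apex a₁,a₂

  -- vertical edges (k , j): south of b_{k,j}, north of b_{k+1,j}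
  -- horizontal edges (i , k): east of b_{i,k}, west of b_{i,k+1}
  -- apex edges (t , c): between a_c and b_τ, τ the t-th element of A
  Es : FinSet
  Es = (finˢ (n ∸ 1) ×ˢ finˢ n) ⊎ˢ (finˢ n ×ˢ finˢ (n ∸ 1)) ⊎ˢ (finˢ L ×ˢ finˢ 2)

  Edge = El Es ⊎ (Dir × Fin n)

  vE : Fin (n ∸ 1) → Fin n → Edge
  vE k j = inj₁ (inj₁ (k , j))
  hE : Fin n → Fin (n ∸ 1) → Edge
  hE i k = inj₁ (inj₂ (inj₁ (i , k)))
  aE : Fin L → Fin 2 → Edge
  aE t c = inj₁ (inj₂ (inj₂ (t , c)))

  orD : Maybe (Fin (n ∸ 1)) → (Fin (n ∸ 1) → Edge) → Edge → Edge
  orD (just k) g d = g k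
  orD nothing  g d = d

  nE sE eE wE : Fin n → Fin n → Edge
  nE i j = orD (before i) (λ k → vE k j) (inj₂ (north , j))
  sE i j = orD (after i)  (λ k → vE k j) (inj₂ (south , j))
  eE i j = orD (after j)  (λ k → hE i k) (inj₂ (east , i))
  wE i j = orD (before j) (λ k → hE i k) (inj₂ (west , i))

  gridVertex : (i j : Fin n) → Dec ((i , j) ∈ A) → VertexData Edge
  gridVertex i j (yes p) = record
    { deg = 6
    ; inc = edges6 (nE i j) (eE i j) (sE i j) (wE i j)
                   (aE (index p) zero) (aE (index p) (suc zero))
    ; fun = PRE }
  gridVertex i j (no _) = record
    { deg = 4 ; inc = edges4 (nE i j) (eE i j) (sE i j) (wE i j) ; fun = PASS }

  apexVertex : Fin 2 → VertexData Edge
  apexVertex c = record { deg = L ; inc = λ t → aE t c ; fun = HW=1 }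

  vertex : El Vs → VertexData Edge
  vertex (inj₁ (i , j)) = gridVertex i j ((i , j) ∈? A)
  vertex (inj₂ c)       = apexVertex c

  gate : Gate
  gate = record { V = Vs ; E = Es ; D = Dir × Fin n ; w = λ _ → + 1 ; vert = vertex }

Γ : (n : ℕ) → Pairs n → Gate
Γ n A = GammaDef.gate n A

-- The gate Γ_↑(A): extended rows 0 (top dummy), 1..n (grid), n+1 (bottom dummy)

module GammaUpDef (n : ℕ) (A : Pairs n) where
  L = length A

  -- b_{i,j} ; dummy b_{0,j} (d = 0) and b_{n+1,j} (d = 1) ; apex a₁,a₂
  Vs : FinSet
  Vs = (finˢ n ×ˢ finˢ n) ⊎ˢ (finˢ 2 ×ˢ finˢ n) ⊎ˢ finˢ 2

  -- vertical edges (k , j), k ∈ {0..n}: south of extended row k,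
  --   north of extended row k+1 (grid row i = extended row i+1)
  -- horizontal edges (i , k) as in Γ(A)
  -- apex edges (t , c) for τ ∈ A as in Γ(A)
  -- dummy apex edges ((d , j) , c): between a_c and dummy vertex (d , j)
  Es : FinSet
  Es = (finˢ (suc n) ×ˢ finˢ n) ⊎ˢ (finˢ n ×ˢ finˢ (n ∸ 1))
       ⊎ˢ (finˢ L ×ˢ finˢ 2) ⊎ˢ ((finˢ 2 ×ˢ finˢ n) ×ˢ finˢ 2)

  Edge = El Es ⊎ (Dir × Fin n)

  vE : Fin (suc n) → Fin n → Edge
  vE k j = inj₁ (inj₁ (k , j))
  hE : Fin n → Fin (n ∸ 1) → Edge
  hE i k = inj₁ (inj₂ (inj₁ (i , k)))
  aE : Fin L → Fin 2 → Edge
  aE t c = inj₁ (inj₂ (inj₂ (inj₁ (t , c))))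
  dE : Fin 2 → Fin n → Fin 2 → Edge
  dE d j c = inj₁ (inj₂ (inj₂ (inj₂ ((d , j) , c))))

  orD : Maybe (Fin (n ∸ 1)) → (Fin (n ∸ 1) → Edge) → Edge → Edge
  orD (just k) g d = g k
  orD nothing  g d = d

  nE sE eE wE : Fin n → Fin n → Edge
  nE i j = vE (inject₁ i) j
  sE i j = vE (suc i) j
  eE i j = orD (after j)  (λ k → hE i k) (inj₂ (east , i))
  wE i j = orD (before j) (λ k → hE i k) (inj₂ (west , i))

  gridVertex : (i j : Fin n) → Dec ((i , j) ∈ A) → VertexData Edge
  gridVertex i j (yes p) = record
    { deg = 6
    ; inc = edges6 (nE i j) (eE i j) (sE i j) (wE i j)
                   (aE (index p) zero) (aE (index p) (suc zero))
    ; fun = PRE }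
  gridVertex i j (no _) = record
    { deg = 4 ; inc = edges4 (nE i j) (eE i j) (sE i j) (wE i j) ; fun = PASS }

  dummyVertex : Fin 2 → Fin n → VertexData Edge
  dummyVertex zero j = record
    { deg = 4
    ; inc = edges4 (inj₂ (north , j)) (vE zero j) (dE zero j zero) (dE zero j (suc zero))
    ; fun = PREdummy }
  dummyVertex (suc _) j = record
    { deg = 4
    ; inc = edges4 (vE (fromℕ n) j) (inj₂ (south , j)) (dE (suc zero) j zero) (dE (suc zero) j (suc zero))
    ; fun = PREdummy }

  apexInc : FinSet
  apexInc = finˢ L ⊎ˢ (finˢ 2 ×ˢ finˢ n)

  apexVertex : Fin 2 → VertexData Edge
  apexVertex c = record
    { deg = size apexInc
    ; inc = λ k → [ (λ t → aE t c) , (λ dj → dE (proj₁ dj) (proj₂ dj) c) ]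
                    (Inverse.to (enum apexInc) k)
    ; fun = HW=1 }

  vertex : El Vs → VertexData Edge
  vertex (inj₁ (i , j))        = gridVertex i j ((i , j) ∈? A)
  vertex (inj₂ (inj₁ (d , j))) = dummyVertex d j
  vertex (inj₂ (inj₂ c))       = apexVertex c

  gate : Gate
  gate = record { V = Vs ; E = Es ; D = Dir × Fin n ; w = λ _ → + 1 ; vert = vertex }

Γ↑ : (n : ℕ) → Pairs n → Gate
Γ↑ n A = GammaUpDef.gate n A

φone : ∀ {n} → (xN xE xS xW : Fin n → Bool) → Set
φone xN xE xS xW = hw xN ≡ 1 × hw xW ≡ 1

φprop : ∀ {n} → (xN xE xS xW : Fin n → Bool) → Set
φprop xN xE xS xW = (∀ j → xN j ≡ xS j) × (∀ i → xW i ≡ xE i)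

-- The apex vertices have signature HW=1, so a configuration of nonzero weight picks one edge at each apex;
-- the cell at its other end carries a marker. PRE and PASS vanish unless the east and west edges agree and the
-- south edge is the north edge flipped once per marker on the cell. Hence every horizontal edge equals x_W
-- (which forces x_E = x_W), each column carries a single vertical wire determined by x_N and its markers, and
-- the signature becomes a sum over pairs of markers of a product of column weights, each of which has a closed
-- form in terms of the positions of the markers and of the horizontal wire (row u).
-- In Γ↑ the pairs of markers inside A reproduce Sig(Γ), since the dummy rows merely pad the columns. Every other
-- pair has a marker on a dummy vertex; for a fixed other marker, putting it on the top or on the bottom dummy of
-- a column gives opposite weights except in the column of the other marker. The surviving terms vanish unless
-- x_N = x_S, and are then counted by the row of A through u, giving n - 2T - 2 or n - 2T + 2.

module Submission where

open import Algebra.Properties.CommutativeSemigroup using (interchange; xy∙z≈xz∙y)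
open import Data.Bool as Bool using (Bool; true; false; if_then_else_; _∧_; _∨_; not; _xor_; T; T?)
open import Data.Bool.Properties using (∧-zeroʳ; ∧-identityʳ; ∨-identityʳ)
open import Data.Empty using (⊥-elim)
open import Data.Fin using (Fin; zero; suc; toℕ; inject₁; fromℕ; _↑ˡ_; _↑ʳ_; combine; _≟_)
open import Data.Fin.Induction using (<-weakInduction)
open import Data.Fin.Properties
  using (all?; splitAt-↑ˡ; splitAt-↑ʳ; remQuot-combine; suc-injective; toℕ-inject₁; toℕ-fromℕ; toℕ-injective; toℕ<n)
open import Data.Fin.Subset using (Subset)
open import Data.Fin.Subset.Properties using (anySubset?)
open import Data.Integer as ℤ using (ℤ; +_; -[1+_]; _+_; _*_; -_; _-_)
open import Data.Integer.Properties
  using (+-identityˡ; +-identityʳ; *-identityˡ; *-identityʳ; +-assoc; *-assoc; +-comm; *-zeroˡ; *-zeroʳ;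
         *-distribˡ-+; *-distribʳ-+; +-inverseˡ; +-inverseʳ; pos-*; +-commutativeSemigroup; *-commutativeSemigroup)
open import Data.Integer.Tactic.RingSolver using (solve-∀)
open import Data.List using (List; []; _∷_; length; lookup)
open import Data.List.Membership.Propositional using (_∈_; _∉_)
open import Data.List.Membership.Propositional.Properties using (∈-lookup)
open import Data.List.Relation.Unary.All as All using ()
open import Data.List.Relation.Unary.AllPairs using ([]; _∷_)
open import Data.List.Relation.Unary.Any using (here; there; index)
open import Data.List.Relation.Unary.Any.Properties using (lookup-index)
open import Data.List.Relation.Unary.Unique.Propositional using (Unique)
open import Data.Maybe using (Maybe; just; nothing)
open import Data.Nat as ℕ using (ℕ; zero; suc; _≡ᵇ_; _<ᵇ_)
open import Data.Nat.Properties using (<-irrefl) renaming (suc-injective to ℕ-suc-injective)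
open import Data.Product as Prod using (∃; _×_; _,_; proj₁; proj₂)
open import Data.Product.Properties using () renaming (≡-dec to ×-≡-dec)
open import Data.Sum as Sum using (_⊎_; inj₁; inj₂; [_,_])
open import Data.Sum.Properties using () renaming (≡-dec to ⊎-≡-dec)
open import Data.Unit using (tt)
open import Data.Vec using (_∷_; [])
open import Defs
open import Function using (_∘_)
open import Function.Bundles using (Inverse)
open import Relation.Binary.Definitions using (DecidableEquality)
open import Relation.Binary.PropositionalEquality hiding ([_])
open import Relation.Nullary using (Dec; yes; no; ¬_; ⌊_⌋; contradiction)
open import Relation.Nullary.Decidable using (isYes≗does; toWitnessFalse; ⌊⌋-map′)

-- Finite sums and products

∑-cong : ∀ k {f g : Fin k → ℤ} → f ≗ g → ∑ k f ≡ ∑ k g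
∑-cong zero    f≗g = refl
∑-cong (suc k) f≗g = cong₂ _+_ (f≗g zero) (∑-cong k (f≗g ∘ suc))

∏-cong : ∀ k {f g : Fin k → ℤ} → f ≗ g → ∏ k f ≡ ∏ k g
∏-cong zero    f≗g = refl
∏-cong (suc k) f≗g = cong₂ _*_ (f≗g zero) (∏-cong k (f≗g ∘ suc))

∑-distrib-+ : ∀ k (f g : Fin k → ℤ) → ∑ k (λ i → f i + g i) ≡ ∑ k f + ∑ k g
∑-distrib-+ zero    f g = refl
∑-distrib-+ (suc k) f g = trans (cong (_+_ (f zero + g zero)) (∑-distrib-+ k (f ∘ suc) (g ∘ suc)))
                                (interchange +-commutativeSemigroup (f zero) (g zero) (∑ k (f ∘ suc)) (∑ k (g ∘ suc)))

∏-distrib-* : ∀ k (f g : Fin k → ℤ) → ∏ k (λ i → f i * g i) ≡ ∏ k f * ∏ k g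
∏-distrib-* zero    f g = refl
∏-distrib-* (suc k) f g = trans (cong ((f zero * g zero) *_) (∏-distrib-* k (f ∘ suc) (g ∘ suc)))
                                (interchange *-commutativeSemigroup (f zero) (g zero) (∏ k (f ∘ suc)) (∏ k (g ∘ suc)))

∑-*ˡ : ∀ k (c : ℤ) (f : Fin k → ℤ) → ∑ k (λ i → c * f i) ≡ c * ∑ k f
∑-*ˡ zero    c f = sym (*-zeroʳ c)
∑-*ˡ (suc k) c f = trans (cong (_+_ (c * f zero)) (∑-*ˡ k c (f ∘ suc))) (sym (*-distribˡ-+ c (f zero) _))

∑-const : ∀ k (c : ℤ) → ∑ k (λ _ → c) ≡ + k * c
∑-const zero    c = refl
∑-const (suc k) c = begin
  c + ∑ k (λ _ → c)   ≡⟨ cong₂ _+_ (sym (*-identityˡ c)) (∑-const k c) ⟩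
  + 1 * c + + k * c   ≡⟨ *-distribʳ-+ c (+ 1) (+ k) ⟨
  + suc k * c         ∎
  where open ≡-Reasoning

∑-zero : ∀ k {f : Fin k → ℤ} → (∀ i → f i ≡ + 0) → ∑ k f ≡ + 0
∑-zero zero    f≡0 = refl
∑-zero (suc k) f≡0 = cong₂ _+_ (f≡0 zero) (∑-zero k (f≡0 ∘ suc))

∏-one : ∀ k {f : Fin k → ℤ} → (∀ i → f i ≡ + 1) → ∏ k f ≡ + 1
∏-one zero    f≡1 = refl
∏-one (suc k) f≡1 = cong₂ _*_ (f≡1 zero) (∏-one k (f≡1 ∘ suc))

∏-zero : ∀ k (f : Fin k → ℤ) (i : Fin k) → f i ≡ + 0 → ∏ k f ≡ + 0
∏-zero (suc k) f zero    fi≡0 = trans (cong (_* ∏ k (f ∘ suc)) fi≡0) (*-zeroˡ (∏ k (f ∘ suc)))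
∏-zero (suc k) f (suc i) fi≡0 = trans (cong (f zero *_) (∏-zero k (f ∘ suc) i fi≡0)) (*-zeroʳ (f zero))

∑-single : ∀ k (f : Fin k → ℤ) (i₀ : Fin k) → (∀ i → i ≢ i₀ → f i ≡ + 0) → ∑ k f ≡ f i₀
∑-single (suc k) f zero     others =
  trans (cong (_+_ (f zero)) (∑-zero k (λ i → others (suc i) (λ ())))) (+-identityʳ (f zero))
∑-single (suc k) f (suc i₀) others =
  trans (cong₂ _+_ (others zero (λ ())) (∑-single k (f ∘ suc) i₀ (λ i i≢i₀ → others (suc i) (i≢i₀ ∘ suc-injective))))
        (+-identityˡ _)

∏-single : ∀ k (f : Fin k → ℤ) (i₀ : Fin k) → (∀ i → i ≢ i₀ → f i ≡ + 1) → ∏ k f ≡ f i₀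
∏-single (suc k) f zero     others =
  trans (cong (f zero *_) (∏-one k (λ i → others (suc i) (λ ())))) (*-identityʳ (f zero))
∏-single (suc k) f (suc i₀) others =
  trans (cong₂ _*_ (others zero (λ ())) (∏-single k (f ∘ suc) i₀ (λ i i≢i₀ → others (suc i) (i≢i₀ ∘ suc-injective))))
        (*-identityˡ _)

∏-init-last : ∀ k (f : Fin (suc k) → ℤ) → ∏ (suc k) f ≡ ∏ k (f ∘ inject₁) * f (fromℕ k)
∏-init-last zero    f = trans (*-identityʳ (f zero)) (sym (*-identityˡ (f zero)))
∏-init-last (suc k) f = trans (cong (f zero *_) (∏-init-last k (f ∘ suc))) (sym (*-assoc (f zero) _ _))

∑-↑ : ∀ m n (f : Fin (m ℕ.+ n) → ℤ) → ∑ (m ℕ.+ n) f ≡ ∑ m (f ∘ (_↑ˡ n)) + ∑ n (f ∘ (m ↑ʳ_))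
∑-↑ zero    n f = sym (+-identityˡ _)
∑-↑ (suc m) n f = trans (cong (_+_ (f zero)) (∑-↑ m n (f ∘ suc))) (sym (+-assoc (f zero) _ _))

∏-↑ : ∀ m n (f : Fin (m ℕ.+ n) → ℤ) → ∏ (m ℕ.+ n) f ≡ ∏ m (f ∘ (_↑ˡ n)) * ∏ n (f ∘ (m ↑ʳ_))
∏-↑ zero    n f = sym (*-identityˡ _)
∏-↑ (suc m) n f = trans (cong (f zero *_) (∏-↑ m n (f ∘ suc))) (sym (*-assoc (f zero) _ _))

∑-combine : ∀ m n (f : Fin (m ℕ.* n) → ℤ) → ∑ (m ℕ.* n) f ≡ ∑ m (λ i → ∑ n (λ j → f (combine i j)))
∑-combine zero    n f = refl
∑-combine (suc m) n f = trans (∑-↑ n (m ℕ.* n) f) (cong (_+_ (∑ n (λ j → f (j ↑ˡ (m ℕ.* n))))) (∑-combine m n (f ∘ (n ↑ʳ_))))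

∏-combine : ∀ m n (f : Fin (m ℕ.* n) → ℤ) → ∏ (m ℕ.* n) f ≡ ∏ m (λ i → ∏ n (λ j → f (combine i j)))
∏-combine zero    n f = refl
∏-combine (suc m) n f = trans (∏-↑ n (m ℕ.* n) f) (cong (∏ n (λ j → f (j ↑ˡ (m ℕ.* n))) *_) (∏-combine m n (f ∘ (n ↑ʳ_))))

∑-comm : ∀ m n (f : Fin m → Fin n → ℤ) → ∑ m (λ i → ∑ n (f i)) ≡ ∑ n (λ j → ∑ m (λ i → f i j))
∑-comm zero    n f = sym (∑-zero n (λ _ → refl))
∑-comm (suc m) n f = trans (cong (_+_ (∑ n (f zero))) (∑-comm m n (f ∘ suc))) (sym (∑-distrib-+ n (f zero) _))

∏-comm : ∀ m n (f : Fin m → Fin n → ℤ) → ∏ m (λ i → ∏ n (f i)) ≡ ∏ n (λ j → ∏ m (λ i → f i j))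
∏-comm zero    n f = sym (∏-one n (λ _ → refl))
∏-comm (suc m) n f = trans (cong (∏ n (f zero) *_) (∏-comm m n (f ∘ suc))) (sym (∏-distrib-* n (f zero) _))

∑ˢ : (S : FinSet) → (El S → ℤ) → ℤ
∑ˢ S f = ∑ (size S) (f ∘ Inverse.to (enum S))

∏ˢ : (S : FinSet) → (El S → ℤ) → ℤ
∏ˢ S f = ∏ (size S) (f ∘ Inverse.to (enum S))

∑ˢ-cong : ∀ S {f g : El S → ℤ} → f ≗ g → ∑ˢ S f ≡ ∑ˢ S g
∑ˢ-cong S f≗g = ∑-cong (size S) (f≗g ∘ Inverse.to (enum S))

module _ (S T : FinSet) where
  private
    toS = Inverse.to (enum S)
    toT = Inverse.to (enum T)

  ∑ˢ-⊎ : ∀ (f : El S ⊎ El T → ℤ) → ∑ˢ (S ⊎ˢ T) f ≡ ∑ˢ S (f ∘ inj₁) + ∑ˢ T (f ∘ inj₂)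
  ∑ˢ-⊎ f = trans (∑-↑ (size S) (size T) _)
    (cong₂ _+_ (∑-cong (size S) (λ k → cong (f ∘ Sum.map toS toT) (splitAt-↑ˡ (size S) k (size T))))
               (∑-cong (size T) (λ k → cong (f ∘ Sum.map toS toT) (splitAt-↑ʳ (size S) (size T) k))))

  ∏ˢ-⊎ : ∀ (f : El S ⊎ El T → ℤ) → ∏ˢ (S ⊎ˢ T) f ≡ ∏ˢ S (f ∘ inj₁) * ∏ˢ T (f ∘ inj₂)
  ∏ˢ-⊎ f = trans (∏-↑ (size S) (size T) _)
    (cong₂ _*_ (∏-cong (size S) (λ k → cong (f ∘ Sum.map toS toT) (splitAt-↑ˡ (size S) k (size T))))
               (∏-cong (size T) (λ k → cong (f ∘ Sum.map toS toT) (splitAt-↑ʳ (size S) (size T) k))))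

  ∑ˢ-× : ∀ (f : El S × El T → ℤ) → ∑ˢ (S ×ˢ T) f ≡ ∑ˢ S (λ a → ∑ˢ T (λ b → f (a , b)))
  ∑ˢ-× f = trans (∑-combine (size S) (size T) _)
    (∑-cong (size S) (λ i → ∑-cong (size T) (λ j → cong (f ∘ Prod.map toS toT) (remQuot-combine i j))))

  ∏ˢ-× : ∀ (f : El S × El T → ℤ) → ∏ˢ (S ×ˢ T) f ≡ ∏ˢ S (λ a → ∏ˢ T (λ b → f (a , b)))
  ∏ˢ-× f = trans (∏-combine (size S) (size T) _)
    (∏-cong (size S) (λ i → ∏-cong (size T) (λ j → cong (f ∘ Prod.map toS toT) (remQuot-combine i j))))

omit : ∀ {k} → Fin k → (Fin k → ℤ) → Fin k → ℤ
omit j H i = if ⌊ i ≟ j ⌋ then + 1 else H i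

omit-here : ∀ {k} (j : Fin k) (H : Fin k → ℤ) → omit j H j ≡ + 1
omit-here j H with j ≟ j
... | yes _   = refl
... | no  j≢j = ⊥-elim (j≢j refl)

omit-elsewhere : ∀ {k} {i j : Fin k} (H : Fin k → ℤ) → i ≢ j → omit j H i ≡ H i
omit-elsewhere {i = i} {j} H i≢j with i ≟ j
... | yes i≡j = ⊥-elim (i≢j i≡j)
... | no  _   = refl

∏-omit : ∀ k (F H : Fin k → ℤ) j → (∀ i → i ≢ j → F i ≡ H i) → ∏ k F ≡ F j * ∏ k (omit j H)
∏-omit k F H j F≡H = begin
  ∏ k F                                    ≡⟨ ∏-cong k split ⟩
  ∏ k (λ i → only i * omit j H i)          ≡⟨ ∏-distrib-* k only (omit j H) ⟩
  ∏ k only * ∏ k (omit j H)                ≡⟨ cong (_* ∏ k (omit j H)) (trans (∏-single k only j only-elsewhere) only-here) ⟩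
  F j * ∏ k (omit j H)                     ∎
  where
  open ≡-Reasoning
  only : Fin k → ℤ
  only i = if ⌊ i ≟ j ⌋ then F j else + 1
  split : ∀ i → F i ≡ only i * omit j H i
  split i with i ≟ j
  ... | yes refl = sym (*-identityʳ (F i))
  ... | no  i≢j  = trans (F≡H i i≢j) (sym (*-identityˡ (H i)))
  only-elsewhere : ∀ i → i ≢ j → only i ≡ + 1
  only-elsewhere i i≢j with i ≟ j
  ... | yes i≡j = ⊥-elim (i≢j i≡j)
  ... | no  _   = refl
  only-here : only j ≡ F j
  only-here with j ≟ j
  ... | yes _   = refl
  ... | no  j≢j = ⊥-elim (j≢j refl)

∏-opposite : ∀ k (F G : Fin k → ℤ) j → (∀ i → i ≢ j → F i ≡ G i) → F j ≡ - G j → ∏ k F + ∏ k G ≡ + 0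
∏-opposite k F G j F≡G Fj≡-Gj = begin
  ∏ k F + ∏ k G            ≡⟨ cong₂ _+_ (∏-omit k F G j F≡G) (∏-omit k G G j (λ _ _ → refl)) ⟩
  F j * R + G j * R        ≡⟨ *-distribʳ-+ R (F j) (G j) ⟨
  (F j + G j) * R          ≡⟨ cong (λ z → (z + G j) * R) Fj≡-Gj ⟩
  (- G j + G j) * R        ≡⟨ cong (_* R) (+-inverseˡ (G j)) ⟩
  + 0 * R                  ≡⟨ *-zeroˡ R ⟩
  + 0                      ∎
  where
  open ≡-Reasoning
  R = ∏ k (omit j G)

-- Summing over edge configurations

∑Bits-cong : ∀ k {F G : (Fin k → Bool) → ℤ} → (∀ y → F y ≡ G y) → ∑Bits k F ≡ ∑Bits k G
∑Bits-cong zero    F≡G = F≡G _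
∑Bits-cong (suc k) F≡G = cong₂ _+_ (∑Bits-cong k (F≡G ∘ (false ◂_))) (∑Bits-cong k (F≡G ∘ (true ◂_)))

∑Bits-zero : ∀ k {F : (Fin k → Bool) → ℤ} → (∀ y → F y ≡ + 0) → ∑Bits k F ≡ + 0
∑Bits-zero zero    F≡0 = F≡0 _
∑Bits-zero (suc k) F≡0 = cong₂ _+_ (∑Bits-zero k (F≡0 ∘ (false ◂_))) (∑Bits-zero k (F≡0 ∘ (true ◂_)))

∑Bits-∑ : ∀ k m (H : (Fin k → Bool) → Fin m → ℤ) →
          ∑Bits k (λ y → ∑ m (H y)) ≡ ∑ m (λ q → ∑Bits k (λ y → H y q))
∑Bits-∑ zero    m H = refl
∑Bits-∑ (suc k) m H = trans (cong₂ _+_ (∑Bits-∑ k m _) (∑Bits-∑ k m _)) (sym (∑-distrib-+ m _ _))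

∑Bits-single : ∀ k (F : (Fin k → Bool) → ℤ) (c : Fin k → Bool) (v : ℤ) →
               (∀ y → y ≗ c → F y ≡ v) → (∀ y → ¬ y ≗ c → F y ≡ + 0) → ∑Bits k F ≡ v
∑Bits-single zero    F c v at-c off-c = at-c _ (λ ())
∑Bits-single (suc k) F c v at-c off-c = split (c zero) refl
  where
  matching : ∀ b → b ≡ c zero → ∑Bits k (F ∘ (b ◂_)) ≡ v
  matching b refl = ∑Bits-single k (F ∘ (b ◂_)) (c ∘ suc) v
    (λ y y≗c → at-c _ λ { zero → refl ; (suc i) → y≗c i })
    (λ y y≉c → off-c _ (λ b◂y≗c → y≉c (b◂y≗c ∘ suc)))
  mismatching : ∀ b → b ≢ c zero → ∑Bits k (F ∘ (b ◂_)) ≡ + 0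
  mismatching b b≢c₀ = ∑Bits-zero k (λ y → off-c _ (λ b◂y≗c → b≢c₀ (b◂y≗c zero)))
  split : ∀ b → c zero ≡ b → ∑Bits (suc k) F ≡ v
  split false c₀ = trans (cong₂ _+_ (matching false (sym c₀)) (mismatching true (λ t≡c₀ → contradiction (trans t≡c₀ c₀) λ ())))
                         (+-identityʳ v)
  split true  c₀ = trans (cong₂ _+_ (mismatching false (λ f≡c₀ → contradiction (trans f≡c₀ c₀) λ ())) (matching true (sym c₀)))
                         (+-identityˡ v)

_≗?_ : ∀ {k} (y c : Fin k → Bool) → Dec (y ≗ c)
y ≗? c = all? (λ i → y i Bool.≟ c i)

restrictTo : ∀ {P : Set} → Dec P → ℤ → ℤ
restrictTo (yes _) z = z
restrictTo (no _)  _ = + 0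

restrictTo-yes : ∀ {P : Set} {z v : ℤ} (p? : Dec P) → P → z ≡ v → restrictTo p? z ≡ v
restrictTo-yes (yes _) _ z≡v = z≡v
restrictTo-yes (no ¬p) p _   = contradiction p ¬p

restrictTo-no : ∀ {P : Set} {z : ℤ} (p? : Dec P) → ¬ P → restrictTo p? z ≡ + 0
restrictTo-no (yes p) ¬p = contradiction p ¬p
restrictTo-no (no _)  _  = refl

restrictTo-zero : ∀ {P : Set} (p? : Dec P) → restrictTo p? (+ 0) ≡ + 0
restrictTo-zero (yes _) = refl
restrictTo-zero (no _)  = refl

module _ (Γ : Gate) (x : Gate.D Γ → Bool) (w≡1 : ∀ e → Gate.w Γ e ≡ + 1) where
  open Gate Γ
  private
    toE   = Inverse.to (enum E)
    fromE = Inverse.from (enum E)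

  weight : (El E → Bool) → ℤ
  weight y = ∏ (size V) (λ k → let open VertexData (vert (Inverse.to (enum V) k)) in fun ([ y , x ] ∘ inc))

  Sig≡∑Bits-weight : Sig Γ x ≡ ∑Bits (size E) (λ y′ → weight (y′ ∘ fromE))
  Sig≡∑Bits-weight = ∑Bits-cong (size E) λ y′ →
    trans (cong (_* weight (y′ ∘ fromE)) (∏-one (size E) (λ k → edge-factor (y′ k)))) (*-identityˡ _)
    where
    edge-factor : ∀ b {k} → (if b then w (toE k) else + 1) ≡ + 1
    edge-factor true  = w≡1 _
    edge-factor false = refl

  Sig-vanishing : (∀ y → weight y ≡ + 0) → Sig Γ x ≡ + 0
  Sig-vanishing weight≡0 = trans Sig≡∑Bits-weight (∑Bits-zero (size E) (λ y′ → weight≡0 (y′ ∘ fromE)))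

  Sig≡∑-support : (K : FinSet) (cand : El K → El E → Bool) (val : El K → ℤ)
    → (∀ y → weight y ≢ + 0 → ∃ λ c → y ≗ cand c)
    → (∀ c c′ y → y ≗ cand c → y ≗ cand c′ → c ≡ c′)
    → (∀ c y → y ≗ cand c → weight y ≡ val c)
    → Sig Γ x ≡ ∑ˢ K val
  Sig≡∑-support K cand val support cand-injective weight-cand = begin
    Sig Γ x
      ≡⟨ Sig≡∑Bits-weight ⟩
    ∑Bits (size E) G
      ≡⟨ ∑Bits-cong (size E) split-by-candidate ⟩
    ∑Bits (size E) (λ y′ → ∑ (size K) (λ q → restrictTo (y′ ≗? cand′ q) (G y′)))
      ≡⟨ ∑Bits-∑ (size E) (size K) (λ y′ q → restrictTo (y′ ≗? cand′ q) (G y′)) ⟩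
    ∑ (size K) (λ q → ∑Bits (size E) (λ y′ → restrictTo (y′ ≗? cand′ q) (G y′)))
      ≡⟨ ∑-cong (size K) (λ q → ∑Bits-single (size E) _ (cand′ q) (val (toK q))
           (λ y′ y′≗ → restrictTo-yes (y′ ≗? cand′ q) y′≗ (weight-cand (toK q) _ (to-El y′ q y′≗)))
           (λ y′ y′≉ → restrictTo-no (y′ ≗? cand′ q) y′≉)) ⟩
    ∑ˢ K val ∎
    where
    open ≡-Reasoning
    toK   = Inverse.to (enum K)
    fromK = Inverse.from (enum K)
    G : (Fin (size E) → Bool) → ℤ
    G y′ = weight (y′ ∘ fromE)
    cand′ : Fin (size K) → Fin (size E) → Bool
    cand′ q = cand (toK q) ∘ toE

    to-El : ∀ y′ q → y′ ≗ cand′ q → (y′ ∘ fromE) ≗ cand (toK q)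
    to-El y′ q y′≗ a = trans (y′≗ (fromE a)) (cong (cand (toK q)) (Inverse.strictlyInverseˡ (enum E) a))

    from-El : ∀ y′ c → (y′ ∘ fromE) ≗ cand c → y′ ≗ cand′ (fromK c)
    from-El y′ c y≗ k = trans (cong y′ (sym (Inverse.strictlyInverseʳ (enum E) k)))
                              (trans (y≗ (toE k)) (cong (λ c′ → cand c′ (toE k)) (sym (Inverse.strictlyInverseˡ (enum K) c))))

    split-by-candidate : ∀ y′ → G y′ ≡ ∑ (size K) (λ q → restrictTo (y′ ≗? cand′ q) (G y′))
    split-by-candidate y′ with G y′ ℤ.≟ + 0
    ... | yes G≡0 rewrite G≡0 = sym (∑-zero (size K) (λ q → restrictTo-zero (y′ ≗? cand′ q)))
    ... | no  G≢0 =
      sym (trans (∑-single (size K) _ (fromK c) unique) (restrictTo-yes (y′ ≗? cand′ (fromK c)) (from-El y′ c y≗c) refl))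
      where
      c = proj₁ (support _ G≢0)
      y≗c = proj₂ (support _ G≢0)
      unique : ∀ q → q ≢ fromK c → restrictTo (y′ ≗? cand′ q) (G y′) ≡ + 0
      unique q q≢ = restrictTo-no (y′ ≗? cand′ q) λ y′≗ →
        q≢ (trans (sym (Inverse.strictlyInverseʳ (enum K) q)) (cong fromK (cand-injective _ _ _ (to-El y′ q y′≗) y≗c)))

lookup-injective : ∀ {X : Set} {xs : List X} → Unique xs → ∀ i j → lookup xs i ≡ lookup xs j → i ≡ j
lookup-injective {xs = x ∷ xs} (x∉ ∷ u) zero    zero    _ = refl
lookup-injective {xs = x ∷ xs} (x∉ ∷ u) zero    (suc j) e = contradiction e (All.lookup x∉ (∈-lookup j))
lookup-injective {xs = x ∷ xs} (x∉ ∷ u) (suc i) zero    e = contradiction (sym e) (All.lookup x∉ (∈-lookup i))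
lookup-injective {xs = x ∷ xs} (x∉ ∷ u) (suc i) (suc j) e = cong suc (lookup-injective u i j e)

⌊⌋-yes : ∀ {P : Set} (p? : Dec P) → P → ⌊ p? ⌋ ≡ true
⌊⌋-yes (yes _) _ = refl
⌊⌋-yes (no ¬p) p = contradiction p ¬p

⌊⌋-no : ∀ {P : Set} (p? : Dec P) → ¬ P → ⌊ p? ⌋ ≡ false
⌊⌋-no (yes p) ¬p = contradiction p ¬p
⌊⌋-no (no _)  _  = refl

⌊⌋-true⇒ : ∀ {P : Set} (p? : Dec P) → ⌊ p? ⌋ ≡ true → P
⌊⌋-true⇒ (yes p) _ = p

⌊⌋-⇔ : ∀ {P Q : Set} → (P → Q) → (Q → P) → (p? : Dec P) (q? : Dec Q) → ⌊ p? ⌋ ≡ ⌊ q? ⌋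
⌊⌋-⇔ to from (yes p) q? = sym (⌊⌋-yes q? (to p))
⌊⌋-⇔ to from (no ¬p) q? = sym (⌊⌋-no q? (¬p ∘ from))

unit-suc : ∀ {k} (t i : Fin k) → unit (suc t) (suc i) ≡ unit t i
unit-suc t i = ⌊⌋-map′ (cong suc) suc-injective (i ≟ t)

hw-cong : ∀ {k} {z z′ : Fin k → Bool} → z ≗ z′ → hw z ≡ hw z′
hw-cong {zero}  z≗z′ = refl
hw-cong {suc k} z≗z′ = cong₂ ℕ._+_ (cong (λ b → if b then 1 else 0) (z≗z′ zero)) (hw-cong (z≗z′ ∘ suc))

hw≡0 : ∀ {k} (z : Fin k → Bool) → hw z ≡ 0 → ∀ i → z i ≡ false
hw≡0 z hw≡ i with z i in zi
... | false = refl
... | true  = contradiction hw≡ (positive z i zi)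
  where
  positive : ∀ {k} (z : Fin k → Bool) i → z i ≡ true → hw z ≢ 0
  positive z zero    zi rewrite zi = λ ()
  positive z (suc i) zi with z zero
  ... | true  = λ ()
  ... | false = positive (z ∘ suc) i zi

hw≡1⇒unit : ∀ {k} (z : Fin k → Bool) → hw z ≡ 1 → ∃ λ t → z ≗ unit t
hw≡1⇒unit {suc k} z hw≡1 with z zero in z₀
... | true  = zero , λ { zero → z₀ ; (suc i) → hw≡0 (z ∘ suc) (cong ℕ.pred hw≡1) i }
... | false with hw≡1⇒unit (z ∘ suc) hw≡1
...   | t , z≗t = suc t , λ { zero → z₀ ; (suc i) → trans (z≗t i) (sym (unit-suc t i)) }

hw-unit : ∀ {k} (t : Fin k) → hw (unit t) ≡ 1
hw-unit {suc k} zero = cong suc (hw-false k)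
  where
  hw-false : ∀ k → hw {k} (λ _ → false) ≡ 0
  hw-false zero    = refl
  hw-false (suc k) = hw-false k
hw-unit (suc t) = trans (hw-cong (unit-suc t)) (hw-unit t)

HW=1≢0 : ∀ {k} (z : Fin k → Bool) → HW=1 z ≢ + 0 → hw z ≡ 1
HW=1≢0 z HW≢0 with hw z
... | 0           = contradiction refl HW≢0
... | 1           = refl
... | suc (suc _) = contradiction refl HW≢0

HW=1-unit : ∀ {k} (z : Fin k → Bool) (t : Fin k) → z ≗ unit t → HW=1 z ≡ + 1
HW=1-unit z t z≗t with hw z | trans (hw-cong z≗t) (hw-unit t)
... | .1 | refl = refl

-- The signatures PASS and PRE

pre-admissible : Subset 6 → Bool
pre-admissible (n ∷ e ∷ s ∷ w ∷ a ∷ b ∷ []) =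
  ⌊ pre n e s w a b ℤ.≟ + 0 ⌋ ∨ (⌊ s Bool.≟ n xor (a xor b) ⌋ ∧ ⌊ e Bool.≟ w ⌋)

-- checked by evaluation on all 64 inputs
all-pre-admissible : ∀ v → T (pre-admissible v)
all-pre-admissible v with pre-admissible v in eq
... | true  = tt
... | false = contradiction (v , subst (T ∘ not) (sym eq) tt)
                (toWitnessFalse {a? = anySubset? (λ v → T? (not (pre-admissible v)))} tt)

pre-support : ∀ n e s w a b → pre n e s w a b ≢ + 0 → s ≡ n xor (a xor b) × e ≡ w
pre-support n e s w a b pre≢0
  with pre n e s w a b ℤ.≟ + 0 | s Bool.≟ n xor (a xor b) | e Bool.≟ w
     | all-pre-admissible (n ∷ e ∷ s ∷ w ∷ a ∷ b ∷ [])
... | yes pre≡0 | _      | _      | _ = contradiction pre≡0 pre≢0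
... | no _      | yes s≡ | yes e≡ | _ = s≡ , e≡

pre-cong : ∀ {n n′ e e′ s s′ w w′ a a′ b b′} → n ≡ n′ → e ≡ e′ → s ≡ s′ → w ≡ w′ → a ≡ a′ → b ≡ b′ →
           pre n e s w a b ≡ pre n′ e′ s′ w′ a′ b′
pre-cong refl refl refl refl refl refl = refl

𝟙 : Bool → ℤ
𝟙 true  = + 1
𝟙 false = + 0

sign : Bool → ℤ
sign true  = -[1+ 0 ]
sign false = + 1

pre-south : ∀ n e s w a b →
            pre n e s w a b ≡ pre n e (n xor (a xor b)) w a b * 𝟙 ⌊ n xor (a xor b) Bool.≟ s ⌋
pre-south n e s w a b with n xor (a xor b) Bool.≟ s
... | yes refl = sym (*-identityʳ _)
... | no  s≢   with pre n e s w a b ℤ.≟ + 0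
...   | yes pre≡0 = trans pre≡0 (sym (*-zeroʳ (pre n e (n xor (a xor b)) w a b)))
...   | no  pre≢0 = contradiction (sym (proj₁ (pre-support n e s w a b pre≢0))) s≢

-- Columns

-- A marker is the row (counted from the top of a column) of the unique cell it sits on; nothing if it is
-- in another column.
marks : Maybe ℕ → ℕ → Bool
marks nothing  r = false
marks (just p) r = p ≡ᵇ r

next : Maybe ℕ → Maybe ℕ
next nothing        = nothing
next (just zero)    = nothing
next (just (suc p)) = just p

marks-next : ∀ m r → marks (next m) r ≡ marks m (suc r)
marks-next nothing        r = refl
marks-next (just zero)    r = refl
marks-next (just (suc p)) r = refl

flips : Maybe ℕ → Maybe ℕ → ℕ → Bool
flips m₁ m₂ r = marks m₁ r xor marks m₂ r

-- the vertical edge entering row r, for top edge x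
wire : Bool → (ℕ → Bool) → ℕ → Bool
wire x f zero    = x
wire x f (suc r) = wire x f r xor f r

wire-suc : ∀ x m₁ m₂ r → wire x (flips m₁ m₂) (suc r) ≡ wire (x xor flips m₁ m₂ 0) (flips (next m₁) (next m₂)) r
wire-suc x m₁ m₂ r = trans (shift x (flips m₁ m₂) r) (sym (wire-cong r))
  where
  shift : ∀ x f r → wire x f (suc r) ≡ wire (x xor f 0) (f ∘ suc) r
  shift x f zero    = refl
  shift x f (suc r) = cong (_xor f (suc r)) (shift x f r)
  wire-cong : ∀ {x} r → wire x (flips (next m₁) (next m₂)) r ≡ wire x (flips m₁ m₂ ∘ suc) r
  wire-cong zero    = refl
  wire-cong (suc r) = cong₂ _xor_ (wire-cong r) (cong₂ _xor_ (marks-next m₁ r) (marks-next m₂ r))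

-- the weight of the cell in row r when the horizontal wire runs through row h
cell : Bool → Maybe ℕ → Maybe ℕ → Maybe ℕ → ℕ → ℤ
cell x m₁ m₂ h r = pre (wire x (flips m₁ m₂) r) (marks h r) (wire x (flips m₁ m₂) (suc r)) (marks h r) (marks m₁ r) (marks m₂ r)

-- the weight of a column of N cells with top edge x and bottom edge xs
column : Bool → Bool → Maybe ℕ → Maybe ℕ → Maybe ℕ → ℕ → ℤ
column x xs m₁ m₂ h zero    = 𝟙 ⌊ x Bool.≟ xs ⌋
column x xs m₁ m₂ h (suc N) = pre x (marks h 0) (x xor flips m₁ m₂ 0) (marks h 0) (marks m₁ 0) (marks m₂ 0)
                            * column (x xor flips m₁ m₂ 0) xs (next m₁) (next m₂) (next h) N

cell-suc : ∀ x m₁ m₂ h r → cell x m₁ m₂ h (suc r) ≡ cell (x xor flips m₁ m₂ 0) (next m₁) (next m₂) (next h) r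
cell-suc x m₁ m₂ h r = pre-cong (wire-suc x m₁ m₂ r) (sym (marks-next h r)) (wire-suc x m₁ m₂ (suc r))
                                (sym (marks-next h r)) (sym (marks-next m₁ r)) (sym (marks-next m₂ r))

∏-cell≡column : ∀ N x xs m₁ m₂ h →
                ∏ N (λ i → cell x m₁ m₂ h (toℕ i)) * 𝟙 ⌊ wire x (flips m₁ m₂) N Bool.≟ xs ⌋ ≡ column x xs m₁ m₂ h N
∏-cell≡column zero    x xs m₁ m₂ h = *-identityˡ _
∏-cell≡column (suc N) x xs m₁ m₂ h = begin
  (cell x m₁ m₂ h 0 * ∏ N (λ i → cell x m₁ m₂ h (suc (toℕ i)))) * 𝟙 ⌊ wire x (flips m₁ m₂) (suc N) Bool.≟ xs ⌋
    ≡⟨ *-assoc (cell x m₁ m₂ h 0) _ _ ⟩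
  cell x m₁ m₂ h 0 * (∏ N (λ i → cell x m₁ m₂ h (suc (toℕ i))) * 𝟙 ⌊ wire x (flips m₁ m₂) (suc N) Bool.≟ xs ⌋)
    ≡⟨ cong (cell x m₁ m₂ h 0 *_) (cong₂ _*_ (∏-cong N (λ i → cell-suc x m₁ m₂ h (toℕ i)))
                                             (cong (λ z → 𝟙 ⌊ z Bool.≟ xs ⌋) (wire-suc x m₁ m₂ N))) ⟩
  cell x m₁ m₂ h 0 * (∏ N (λ i → cell x′ (next m₁) (next m₂) (next h) (toℕ i))
                       * 𝟙 ⌊ wire x′ (flips (next m₁) (next m₂)) N Bool.≟ xs ⌋)
    ≡⟨ cong (cell x m₁ m₂ h 0 *_) (∏-cell≡column N x′ xs (next m₁) (next m₂) (next h)) ⟩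
  column x xs m₁ m₂ h (suc N) ∎
  where
  open ≡-Reasoning
  x′ = x xor flips m₁ m₂ 0

holdsAt : Maybe ℕ → (ℕ → Bool) → Bool
holdsAt nothing  P = false
holdsAt (just u) P = P u

column-unmarked-top : ∀ N x xs m₁ m₂ h → marks m₁ 0 ≡ false → marks m₂ 0 ≡ false →
                      column x xs m₁ m₂ h (suc N) ≡ sign (x ∧ marks h 0) * column x xs (next m₁) (next m₂) (next h) N
column-unmarked-top N x xs m₁ m₂ h m₁₀ m₂₀ rewrite m₁₀ | m₂₀ = pass-row x (marks h 0)
  where
  pass-row : ∀ x e → pre x e (x xor false) e false false * column (x xor false) xs (next m₁) (next m₂) (next h) N
                   ≡ sign (x ∧ e) * column x xs (next m₁) (next m₂) (next h) N
  pass-row true  true  = refl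
  pass-row true  false = refl
  pass-row false true  = refl
  pass-row false false = refl

-- An unmarked top row contributes -1 exactly when the horizontal wire crosses an active vertical edge there.
column-step : ∀ N x xs m₁ m₂ h c (Q : ℕ → Bool) → marks m₁ 0 ≡ false → marks m₂ 0 ≡ false → (c ≡ true → Q 0 ≡ x) →
              column x xs (next m₁) (next m₂) (next h) N ≡ 𝟙 c * sign (holdsAt (next h) (Q ∘ suc)) →
              column x xs m₁ m₂ h (suc N) ≡ 𝟙 c * sign (holdsAt h Q)
column-step N x xs m₁ m₂ h c Q m₁₀ m₂₀ Q₀ rest =
  trans (column-unmarked-top N x xs m₁ m₂ h m₁₀ m₂₀) (trans (cong (sign (x ∧ marks h 0) *_) rest) (shift h c refl))
  where
  ∧-false : ∀ x → sign (x ∧ false) ≡ + 1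
  ∧-false true  = refl
  ∧-false false = refl
  shift : ∀ h b → c ≡ b → sign (x ∧ marks h 0) * (𝟙 b * sign (holdsAt (next h) (Q ∘ suc))) ≡ 𝟙 b * sign (holdsAt h Q)
  shift nothing        b     _   = trans (cong (_* (𝟙 b * + 1)) (∧-false x)) (*-identityˡ _)
  shift (just (suc u)) b     _   = trans (cong (_* (𝟙 b * sign (Q (suc u)))) (∧-false x)) (*-identityˡ _)
  shift (just zero)    false _   = *-zeroʳ (sign (x ∧ true))
  shift (just zero)    true  c≡t = trans (cases x) (cong (λ b → + 1 * sign b) (sym (Q₀ c≡t)))
    where
    cases : ∀ x → sign (x ∧ true) * (+ 1 * + 1) ≡ + 1 * sign x
    cases true  = refl
    cases false = refl

∧-true⇒ˡ : ∀ {a b} → a ∧ b ≡ true → a ≡ true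
∧-true⇒ˡ {true} _ = refl

not-∧-true⇒ : ∀ {a b} → not a ∧ b ≡ true → a ≡ false
not-∧-true⇒ {false} _ = refl

column-unmarked : ∀ N x xs h → column x xs nothing nothing h N ≡ 𝟙 ⌊ x Bool.≟ xs ⌋ * sign (holdsAt h (λ u → (u <ᵇ N) ∧ x))
column-unmarked zero    x xs nothing  = sym (*-identityʳ _)
column-unmarked zero    x xs (just u) = sym (*-identityʳ _)
column-unmarked (suc N) x xs h =
  column-step N x xs nothing nothing h ⌊ x Bool.≟ xs ⌋ (λ u → (u <ᵇ suc N) ∧ x) refl refl (λ _ → refl)
              (column-unmarked N x xs (next h))

column-marked₂ : ∀ N p x xs h → (p <ᵇ N) ≡ true →
                 column x xs nothing (just p) h N ≡ 𝟙 (x ∧ not xs) * sign (holdsAt h (λ u → u <ᵇ p))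
column-marked₂ (suc N) zero    x xs h _ =
  trans (cong (pre x (marks h 0) (x xor true) (marks h 0) false true *_) (column-unmarked N (x xor true) xs (next h)))
        (first h x xs)
  where
  first : ∀ h x xs → pre x (marks h 0) (x xor true) (marks h 0) false true
                       * (𝟙 ⌊ (x xor true) Bool.≟ xs ⌋ * sign (holdsAt (next h) (λ u → (u <ᵇ N) ∧ (x xor true))))
                   ≡ 𝟙 (x ∧ not xs) * sign (holdsAt h (λ u → u <ᵇ 0))
  first nothing        true  true  = refl
  first nothing        true  false = refl
  first nothing        false xs    = refl
  first (just zero)    true  true  = refl
  first (just zero)    true  false = refl
  first (just zero)    false xs    = refl
  first (just (suc u)) true  true  = refl
  first (just (suc u)) true  false = cong (λ b → + 1 * (+ 1 * sign b)) (∧-zeroʳ (u <ᵇ N))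
  first (just (suc u)) false xs    = refl
column-marked₂ (suc N) (suc p) x xs h p<N =
  column-step N x xs nothing (just (suc p)) h (x ∧ not xs) (λ u → u <ᵇ suc p) refl refl (sym ∘ ∧-true⇒ˡ)
              (column-marked₂ N p x xs (next h) p<N)

column-marked₁ : ∀ N p x xs h → (p <ᵇ N) ≡ true →
                 column x xs (just p) nothing h N ≡ 𝟙 (not x ∧ xs) * sign (holdsAt h (λ u → (p <ᵇ u) ∧ (u <ᵇ N)))
column-marked₁ (suc N) zero    x xs h _ =
  trans (cong (pre x (marks h 0) (x xor true) (marks h 0) true false *_) (column-unmarked N (x xor true) xs (next h)))
        (first h x xs)
  where
  first : ∀ h x xs → pre x (marks h 0) (x xor true) (marks h 0) true false
                       * (𝟙 ⌊ (x xor true) Bool.≟ xs ⌋ * sign (holdsAt (next h) (λ u → (u <ᵇ N) ∧ (x xor true))))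
                   ≡ 𝟙 (not x ∧ xs) * sign (holdsAt h (λ u → (0 <ᵇ u) ∧ (u <ᵇ suc N)))
  first nothing        false true  = refl
  first nothing        false false = refl
  first nothing        true  xs    = refl
  first (just zero)    false true  = refl
  first (just zero)    false false = refl
  first (just zero)    true  xs    = refl
  first (just (suc u)) false true  =
    trans (cong (+ 1 *_) (*-identityˡ (sign ((u <ᵇ N) ∧ true)))) (cong (λ b → + 1 * sign b) (∧-identityʳ (u <ᵇ N)))
  first (just (suc u)) false false = refl
  first (just (suc u)) true  xs    = refl
column-marked₁ (suc N) (suc p) x xs h p<N =
  column-step N x xs (just (suc p)) nothing h (not x ∧ xs) (λ u → (suc p <ᵇ u) ∧ (u <ᵇ suc N)) refl refl
              (sym ∘ not-∧-true⇒) (column-marked₁ N p x xs (next h) p<N)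

column-marked-twice : ∀ N p x xs h → (p <ᵇ N) ≡ true →
                      column x xs (just p) (just p) h N ≡ 𝟙 (x ∧ xs) * sign (holdsAt h (λ u → not (u ≡ᵇ p) ∧ (u <ᵇ N)))
column-marked-twice (suc N) zero    x xs h _ =
  trans (cong (pre x (marks h 0) (x xor false) (marks h 0) true true *_) (column-unmarked N (x xor false) xs (next h)))
        (first h x xs)
  where
  first : ∀ h x xs → pre x (marks h 0) (x xor false) (marks h 0) true true
                       * (𝟙 ⌊ (x xor false) Bool.≟ xs ⌋ * sign (holdsAt (next h) (λ u → (u <ᵇ N) ∧ (x xor false))))
                   ≡ 𝟙 (x ∧ xs) * sign (holdsAt h (λ u → not (u ≡ᵇ 0) ∧ (u <ᵇ suc N)))
  first nothing        true  true  = refl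
  first nothing        true  false = refl
  first nothing        false xs    = refl
  first (just zero)    true  true  = refl
  first (just zero)    true  false = refl
  first (just zero)    false xs    = refl
  first (just (suc u)) true  true  =
    trans (cong (+ 1 *_) (*-identityˡ (sign ((u <ᵇ N) ∧ true)))) (cong (λ b → + 1 * sign b) (∧-identityʳ (u <ᵇ N)))
  first (just (suc u)) true  false = refl
  first (just (suc u)) false xs    = refl
column-marked-twice (suc N) (suc p) x xs h p<N =
  column-step N x xs (just (suc p)) (just (suc p)) h (x ∧ xs) (λ u → not (u ≡ᵇ suc p) ∧ (u <ᵇ suc N)) refl refl
              (sym ∘ ∧-true⇒ˡ) (column-marked-twice N p x xs (next h) p<N)

column-marked₁<₂ : ∀ N p₁ p₂ x xs h → (p₁ <ᵇ p₂) ≡ true → (p₂ <ᵇ N) ≡ true →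
                   column x xs (just p₁) (just p₂) h N ≡ 𝟙 (not x ∧ not xs) * sign (holdsAt h (λ u → (p₁ <ᵇ u) ∧ (u <ᵇ p₂)))
column-marked₁<₂ (suc N) zero     (suc p₂) x xs h _ p₂<N =
  trans (cong (pre x (marks h 0) (x xor true) (marks h 0) true false *_) (column-marked₂ N p₂ (x xor true) xs (next h) p₂<N))
        (first h x xs)
  where
  first : ∀ h x xs → pre x (marks h 0) (x xor true) (marks h 0) true false
                       * (𝟙 ((x xor true) ∧ not xs) * sign (holdsAt (next h) (λ u → u <ᵇ p₂)))
                   ≡ 𝟙 (not x ∧ not xs) * sign (holdsAt h (λ u → (0 <ᵇ u) ∧ (u <ᵇ suc p₂)))
  first nothing        false true  = refl
  first nothing        false false = refl
  first nothing        true  xs    = refl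
  first (just zero)    false true  = refl
  first (just zero)    false false = refl
  first (just zero)    true  xs    = refl
  first (just (suc u)) false true  = *-identityˡ _
  first (just (suc u)) false false = *-identityˡ _
  first (just (suc u)) true  xs    = refl
column-marked₁<₂ (suc N) (suc p₁) (suc p₂) x xs h p₁<p₂ p₂<N =
  column-step N x xs (just (suc p₁)) (just (suc p₂)) h (not x ∧ not xs) (λ u → (suc p₁ <ᵇ u) ∧ (u <ᵇ suc p₂)) refl refl
              (sym ∘ not-∧-true⇒) (column-marked₁<₂ N p₁ p₂ x xs (next h) p₁<p₂ p₂<N)

column-marked₂<₁ : ∀ N p₁ p₂ x xs h → (p₂ <ᵇ p₁) ≡ true → (p₁ <ᵇ N) ≡ true →
                   column x xs (just p₁) (just p₂) h N ≡ 𝟙 (x ∧ xs) * sign (holdsAt h (λ u → (u <ᵇ p₂) ∨ ((p₁ <ᵇ u) ∧ (u <ᵇ N))))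
column-marked₂<₁ (suc N) (suc p₁) zero     x xs h _ p₁<N =
  trans (cong (pre x (marks h 0) (x xor true) (marks h 0) false true *_) (column-marked₁ N p₁ (x xor true) xs (next h) p₁<N))
        (first h x xs)
  where
  first : ∀ h x xs → pre x (marks h 0) (x xor true) (marks h 0) false true
                       * (𝟙 (not (x xor true) ∧ xs) * sign (holdsAt (next h) (λ u → (p₁ <ᵇ u) ∧ (u <ᵇ N))))
                   ≡ 𝟙 (x ∧ xs) * sign (holdsAt h (λ u → (u <ᵇ 0) ∨ ((suc p₁ <ᵇ u) ∧ (u <ᵇ suc N))))
  first nothing        true  true  = refl
  first nothing        true  false = refl
  first nothing        false xs    = refl
  first (just zero)    true  true  = refl
  first (just zero)    true  false = refl
  first (just zero)    false xs    = refl
  first (just (suc u)) true  true  = *-identityˡ _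
  first (just (suc u)) true  false = *-identityˡ _
  first (just (suc u)) false xs    = refl
column-marked₂<₁ (suc N) (suc p₁) (suc p₂) x xs h p₂<p₁ p₁<N =
  column-step N x xs (just (suc p₁)) (just (suc p₂)) h (x ∧ xs) (λ u → (u <ᵇ suc p₂) ∨ ((suc p₁ <ᵇ u) ∧ (u <ᵇ suc N)))
              refl refl (sym ∘ ∧-true⇒ˡ) (column-marked₂<₁ N p₁ p₂ x xs (next h) p₂<p₁ p₁<N)

within : Maybe ℕ → ℕ → Bool
within nothing  N = true
within (just p) N = p <ᵇ N

within-next : ∀ m N → within m (suc N) ≡ true → within (next m) N ≡ true
within-next nothing        N _   = refl
within-next (just zero)    N _   = refl
within-next (just (suc p)) N p<N = p<N

column-drop-last : ∀ N x xs m₁ m₂ h → within m₁ N ≡ true → within m₂ N ≡ true → within h N ≡ true →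
                   column x xs m₁ m₂ h (suc N) ≡ column x xs m₁ m₂ h N
column-drop-last zero    true  true  nothing  nothing  nothing  _ _ _  = refl
column-drop-last zero    true  false nothing  nothing  nothing  _ _ _  = refl
column-drop-last zero    false true  nothing  nothing  nothing  _ _ _  = refl
column-drop-last zero    false false nothing  nothing  nothing  _ _ _  = refl
column-drop-last zero    x     xs    nothing  nothing  (just _) _ _ ()
column-drop-last zero    x     xs    nothing  (just _) h        _ () _
column-drop-last zero    x     xs    (just _) m₂       h        () _ _
column-drop-last (suc N) x     xs    m₁       m₂       h        m₁<N m₂<N h<N =
  cong (pre x (marks h 0) (x xor (marks m₁ 0 xor marks m₂ 0)) (marks h 0) (marks m₁ 0) (marks m₂ 0) *_)
       (column-drop-last N _ xs (next m₁) (next m₂) (next h)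
                         (within-next m₁ N m₁<N) (within-next m₂ N m₂<N) (within-next h N h<N))

below : Maybe ℕ → Maybe ℕ
below nothing  = nothing
below (just p) = just (suc p)

column-pad : ∀ N x xs m₁ m₂ u → within m₁ N ≡ true → within m₂ N ≡ true → (u <ᵇ N) ≡ true →
             column x xs (below m₁) (below m₂) (just (suc u)) (suc (suc N)) ≡ column x xs m₁ m₂ (just u) N
column-pad N x xs m₁ m₂ u m₁<N m₂<N u<N = trans (top-row x m₁ m₂) (column-drop-last N x xs m₁ m₂ (just u) m₁<N m₂<N u<N)
  where
  top-row : ∀ x m₁ m₂ → column x xs (below m₁) (below m₂) (just (suc u)) (suc (suc N)) ≡ column x xs m₁ m₂ (just u) (suc N)
  top-row true  nothing  nothing  = *-identityˡ _
  top-row true  nothing  (just _) = *-identityˡ _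
  top-row true  (just _) nothing  = *-identityˡ _
  top-row true  (just _) (just _) = *-identityˡ _
  top-row false nothing  nothing  = *-identityˡ _
  top-row false nothing  (just _) = *-identityˡ _
  top-row false (just _) nothing  = *-identityˡ _
  top-row false (just _) (just _) = *-identityˡ _

-- Markers

_≟ᵖ_ : ∀ {n} → DecidableEquality (ℕ × Fin n)
_≟ᵖ_ = ×-≡-dec ℕ._≟_ _≟_

-- the marker in column j of an apex edge ending at the cell in row r and column c
markerAt : ∀ {n} → ℕ × Fin n → Fin n → Maybe ℕ
markerAt (r , c) j = if ⌊ c ≟ j ⌋ then just r else nothing

marks-markerAt : ∀ {n} (p : ℕ × Fin n) r j → marks (markerAt p j) r ≡ ⌊ p ≟ᵖ (r , j) ⌋
marks-markerAt (r₀ , c) r j with c ≟ j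
... | yes refl = trans (sym (isYes≗does (r₀ ℕ.≟ r))) (⌊⌋-⇔ (cong (_, c)) (cong proj₁) _ _)
... | no  c≢j  = sym (⌊⌋-no _ (c≢j ∘ cong proj₂))

markerAt-here : ∀ {n} r (c : Fin n) → markerAt (r , c) c ≡ just r
markerAt-here r c with c ≟ c
... | yes _   = refl
... | no  c≢c = contradiction refl c≢c

markerAt-elsewhere : ∀ {n} r {c j : Fin n} → c ≢ j → markerAt (r , c) j ≡ nothing
markerAt-elsewhere r {c} {j} c≢j with c ≟ j
... | yes c≡j = contradiction c≡j c≢j
... | no  _   = refl

markerAt-suc : ∀ {n} r (c j : Fin n) → markerAt (suc r , c) j ≡ below (markerAt (r , c) j)
markerAt-suc r c j with ⌊ c ≟ j ⌋
... | true  = refl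
... | false = refl

markerAt-within : ∀ {n} {r N} (c j : Fin n) → (r ℕ.<ᵇ N) ≡ true → within (markerAt (r , c) j) N ≡ true
markerAt-within c j r<N with ⌊ c ≟ j ⌋
... | true  = r<N
... | false = refl

pick : ∀ {X : Set} → Fin 2 → X → X → X
pick zero    a b = a
pick (suc _) a b = b

module Placement {O : Set} {n} (_≟O_ : DecidableEquality O) (position : O → ℕ × Fin n)
                 (position-injective : ∀ {o o′} → position o ≡ position o′ → o ≡ o′) where

  marker : O → Fin n → Maybe ℕ
  marker c = markerAt (position c)

  marks-occupied : ∀ o c {r j} → position o ≡ (r , j) → marks (marker c j) r ≡ ⌊ o ≟O c ⌋
  marks-occupied o c {r} {j} o-at = trans (marks-markerAt (position c) r j)
    (⌊⌋-⇔ (λ c-at → position-injective (trans o-at (sym c-at))) (λ { refl → o-at }) _ _)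

  marks-vacant : ∀ c {r j} → (∀ o → position o ≢ (r , j)) → marks (marker c j) r ≡ false
  marks-vacant c {r} {j} vacant = trans (marks-markerAt (position c) r j) (⌊⌋-no _ (vacant c))

marks-toℕ : ∀ {n} (u i : Fin n) → marks (just (toℕ u)) (toℕ i) ≡ unit u i
marks-toℕ u i = trans (sym (isYes≗does (toℕ u ℕ.≟ toℕ i))) (⌊⌋-⇔ (sym ∘ toℕ-injective) (cong toℕ ∘ sym) _ _)

-- The signature of Γ(A)

after′-inject₁ : ∀ {m} (k : Fin m) → after′ (inject₁ k) ≡ just k
after′-inject₁ {suc m} zero    = refl
after′-inject₁ {suc m} (suc k) rewrite after′-inject₁ k = refl

after′-last : ∀ m → after′ (fromℕ m) ≡ nothing
after′-last zero    = refl
after′-last (suc m) rewrite after′-last m = refl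

module GammaWeights {m : ℕ} (A : Pairs (suc m)) (A-unique : Unique A) (xN xE xS xW : Fin (suc m) → Bool) where
  open GammaDef (suc m) A

  x : Dir × Fin (suc m) → Bool
  x = assemble xN xE xS xW

  Config : Set
  Config = El Es → Bool

  edge : Config → Edge → Bool
  edge y = [ y , x ]

  factor : Config → El Vs → ℤ
  factor y v = VertexData.fun (vertex v) (edge y ∘ VertexData.inc (vertex v))

  position : Fin L → ℕ × Fin (suc m)
  position t = Prod.map₁ toℕ (lookup A t)

  position-injective : ∀ {t t′} → position t ≡ position t′ → t ≡ t′
  position-injective {t} {t′} eq = lookup-injective A-unique t t′
    (cong₂ _,_ (toℕ-injective (cong proj₁ eq)) (cong proj₂ eq))

  open Placement _≟_ position position-injective public

  wireAt : Fin L → Fin L → Fin (suc m) → ℕ → Bool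
  wireAt t₁ t₂ j = wire (xN j) (flips (marker t₁ j) (marker t₂ j))

  ApexChoice : Config → Fin L → Fin L → Set
  ApexChoice y t₁ t₂ = ∀ t c → y (inj₂ (inj₂ (t , c))) ≡ unit (pick c t₁ t₂) t

  factor-grid : ∀ y t₁ t₂ → ApexChoice y t₁ t₂ → ∀ i j →
                factor y (inj₁ (i , j)) ≡ pre (edge y (nE i j)) (edge y (eE i j)) (edge y (sE i j)) (edge y (wE i j))
                                              (marks (marker t₁ j) (toℕ i)) (marks (marker t₂ j) (toℕ i))
  factor-grid y t₁ t₂ apex i j with (i , j) ∈? A
  ... | yes p = cong₂ (pre _ _ _ _) (trans (apex (index p) zero) (sym (marks-occupied _ t₁ at)))
                                    (trans (apex (index p) (suc zero)) (sym (marks-occupied _ t₂ at)))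
    where at = cong (Prod.map₁ toℕ) (sym (lookup-index p))
  ... | no  p∉ = sym (cong₂ (pre _ _ _ _) (marks-vacant t₁ vacant) (marks-vacant t₂ vacant))
    where vacant : ∀ t → position t ≢ (toℕ i , j)
          vacant t eq = p∉ (subst (_∈ A) (cong₂ _,_ (toℕ-injective (cong proj₁ eq)) (cong proj₂ eq)) (∈-lookup t))

  east-inner : ∀ y i k → edge y (eE i (inject₁ k)) ≡ y (inj₂ (inj₁ (i , k)))
  east-inner y i k rewrite after′-inject₁ k = refl

  east-last : ∀ y i → edge y (eE i (fromℕ m)) ≡ xE i
  east-last y i rewrite after′-last m = refl

  south-inner : ∀ y k j → edge y (sE (inject₁ k) j) ≡ y (inj₁ (k , j))
  south-inner y k j rewrite after′-inject₁ k = refl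

  south-last : ∀ y j → edge y (sE (fromℕ m) j) ≡ xS j
  south-last y j rewrite after′-last m = refl

  candidate : Fin L × Fin L → Config
  candidate (t₁ , t₂) (inj₁ (k , j))         = wireAt t₁ t₂ j (suc (toℕ k))
  candidate (t₁ , t₂) (inj₂ (inj₁ (i , k)))  = xW i
  candidate (t₁ , t₂) (inj₂ (inj₂ (t , c)))  = unit (pick c t₁ t₂) t

  weightΓ : Config → ℤ
  weightΓ = weight (Γ (suc m) A) x (λ _ → refl)

  factor≢0 : ∀ y → weightΓ y ≢ + 0 → ∀ v → factor y v ≢ + 0
  factor≢0 y w≢0 v f≡0 = w≢0 (∏-zero (size Vs) (factor y ∘ Inverse.to (enum Vs)) (Inverse.from (enum Vs) v)
    (subst (λ v′ → factor y v′ ≡ + 0) (sym (Inverse.strictlyInverseˡ (enum Vs) v)) f≡0))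

  module Support (y : Config) (w≢0 : weightΓ y ≢ + 0) where
    chosen : ∀ c → ∃ λ t → (λ t′ → y (inj₂ (inj₂ (t′ , c)))) ≗ unit t
    chosen c = hw≡1⇒unit apexEdges (HW=1≢0 apexEdges (factor≢0 y w≢0 (inj₂ c)))
      where apexEdges = λ t′ → y (inj₂ (inj₂ (t′ , c)))

    t₁ t₂ : Fin L
    t₁ = proj₁ (chosen zero)
    t₂ = proj₁ (chosen (suc zero))

    apex : ApexChoice y t₁ t₂
    apex t zero       = proj₂ (chosen zero) t
    apex t (suc zero) = proj₂ (chosen (suc zero)) t

    local : ∀ i j → edge y (sE i j) ≡ edge y (nE i j) xor flips (marker t₁ j) (marker t₂ j) (toℕ i)
                  × edge y (eE i j) ≡ edge y (wE i j)
    local i j = pre-support (edge y (nE i j)) (edge y (eE i j)) (edge y (sE i j)) (edge y (wE i j))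
                            (marks (marker t₁ j) (toℕ i)) (marks (marker t₂ j) (toℕ i))
                            (λ pre≡0 → factor≢0 y w≢0 (inj₁ (i , j)) (trans (factor-grid y t₁ t₂ apex i j) pre≡0))

    west-edge : ∀ i j → edge y (wE i j) ≡ xW i
    west-edge i = <-weakInduction (λ j → edge y (wE i j) ≡ xW i) refl
      (λ k w≡ → trans (sym (east-inner y i k)) (trans (proj₂ (local i (inject₁ k))) w≡))

    north-edge : ∀ j i → edge y (nE i j) ≡ wireAt t₁ t₂ j (toℕ i)
    north-edge j = <-weakInduction (λ i → edge y (nE i j) ≡ wireAt t₁ t₂ j (toℕ i)) refl
      (λ k n≡ → trans (sym (south-inner y k j)) (trans (proj₁ (local (inject₁ k) j))
         (subst (λ r → edge y (nE (inject₁ k) j) xor flips (marker t₁ j) (marker t₂ j) r ≡ wireAt t₁ t₂ j (suc (toℕ k)))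
                (sym (toℕ-inject₁ k))
                (cong (_xor flips (marker t₁ j) (marker t₂ j) (toℕ k)) (trans n≡ (cong (wireAt t₁ t₂ j) (toℕ-inject₁ k)))))))

    east≡west : ∀ i → xE i ≡ xW i
    east≡west i = trans (sym (east-last y i)) (trans (proj₂ (local i (fromℕ m))) (west-edge i (fromℕ m)))

    y≗candidate : y ≗ candidate (t₁ , t₂)
    y≗candidate (inj₁ (k , j))        = north-edge j (suc k)
    y≗candidate (inj₂ (inj₁ (i , k))) = west-edge i (suc k)
    y≗candidate (inj₂ (inj₂ (t , c))) = apex t c

  candidate-injective : ∀ c c′ y → y ≗ candidate c → y ≗ candidate c′ → c ≡ c′
  candidate-injective (t₁ , t₂) (t₁′ , t₂′) y y≗c y≗c′ = cong₂ _,_ (same zero) (same (suc zero))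
    where
    same : ∀ c → pick c t₁ t₂ ≡ pick c t₁′ t₂′
    same c = ⌊⌋-true⇒ (pick c t₁ t₂ ≟ pick c t₁′ t₂′)
      (trans (sym (y≗c′ (inj₂ (inj₂ (pick c t₁ t₂ , c)))))
             (trans (y≗c (inj₂ (inj₂ (pick c t₁ t₂ , c)))) (⌊⌋-yes (pick c t₁ t₂ ≟ pick c t₁ t₂) refl)))

  Sig≡0 : ¬ (∀ i → xE i ≡ xW i) → Sig (Γ (suc m) A) x ≡ + 0
  Sig≡0 ¬east≡west = Sig-vanishing (Γ (suc m) A) x (λ _ → refl) λ y → case (weightΓ y ℤ.≟ + 0)
    where
    case : ∀ {y} → Dec (weightΓ y ≡ + 0) → weightΓ y ≡ + 0
    case (yes w≡0)   = w≡0
    case {y} (no w≢0) = contradiction (Support.east≡west y w≢0) ¬east≡west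

  module Evaluation (u : Fin (suc m)) (xW≗u : xW ≗ unit u) (east≡west : ∀ i → xE i ≡ xW i) where
    h : Maybe ℕ
    h = just (toℕ u)

    value : Fin L × Fin L → ℤ
    value (t₁ , t₂) = ∏ (suc m) (λ j → column (xN j) (xS j) (marker t₁ j) (marker t₂ j) h (suc m))

    module _ (t₁ t₂ : Fin L) (y : Config) (y≗ : y ≗ candidate (t₁ , t₂)) where
      apex : ApexChoice y t₁ t₂
      apex t c = y≗ (inj₂ (inj₂ (t , c)))

      west-edge : ∀ i j → edge y (wE i j) ≡ marks h (toℕ i)
      west-edge i zero    = trans (xW≗u i) (sym (marks-toℕ u i))
      west-edge i (suc k) = trans (y≗ _) (trans (xW≗u i) (sym (marks-toℕ u i)))

      east-edge : ∀ i j → edge y (eE i j) ≡ marks h (toℕ i)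
      east-edge i j with after j
      ... | just k  = trans (y≗ _) (trans (xW≗u i) (sym (marks-toℕ u i)))
      ... | nothing = trans (east≡west i) (trans (xW≗u i) (sym (marks-toℕ u i)))

      north-edge : ∀ i j → edge y (nE i j) ≡ wireAt t₁ t₂ j (toℕ i)
      north-edge zero    j = refl
      north-edge (suc k) j = y≗ _

      module _ (j : Fin (suc m)) where
        c : ℕ → ℤ
        c = cell (xN j) (marker t₁ j) (marker t₂ j) h

        cellWith : ℕ → Bool → ℤ
        cellWith r s = pre (wireAt t₁ t₂ j r) (marks h r) s (marks h r) (marks (marker t₁ j) r) (marks (marker t₂ j) r)

        factor-cell : ∀ i → factor y (inj₁ (i , j)) ≡ cellWith (toℕ i) (edge y (sE i j))
        factor-cell i = trans (factor-grid y t₁ t₂ apex i j)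
          (pre-cong (north-edge i j) (east-edge i j) (refl {x = edge y (sE i j)}) (west-edge i j)
                    (refl {x = marks (marker t₁ j) (toℕ i)}) (refl {x = marks (marker t₂ j) (toℕ i)}))

        factor-inner : ∀ k → factor y (inj₁ (inject₁ k , j)) ≡ c (toℕ k)
        factor-inner k = trans (factor-cell (inject₁ k))
          (trans (cong (cellWith r) (trans (south-inner y k j) (trans (y≗ _) (cong (wireAt t₁ t₂ j ∘ suc) (sym (toℕ-inject₁ k))))))
                 (cong c (toℕ-inject₁ k)))
          where r = toℕ (inject₁ k)

        factor-last : factor y (inj₁ (fromℕ m , j)) ≡ c m * 𝟙 ⌊ wireAt t₁ t₂ j (suc m) Bool.≟ xS j ⌋
        factor-last = trans (factor-cell (fromℕ m))
          (trans (cong (cellWith r) (south-last y j))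
          (trans (pre-south (wireAt t₁ t₂ j r) (marks h r) (xS j) (marks h r) (marks (marker t₁ j) r) (marks (marker t₂ j) r))
                 (cong (λ r → c r * 𝟙 ⌊ wireAt t₁ t₂ j (suc r) Bool.≟ xS j ⌋) (toℕ-fromℕ m))))
          where r = toℕ (fromℕ m)

        column-weight : ∏ (suc m) (λ i → factor y (inj₁ (i , j))) ≡ column (xN j) (xS j) (marker t₁ j) (marker t₂ j) h (suc m)
        column-weight = begin
          ∏ (suc m) (λ i → factor y (inj₁ (i , j)))
            ≡⟨ ∏-init-last m (λ i → factor y (inj₁ (i , j))) ⟩
          ∏ m (λ k → factor y (inj₁ (inject₁ k , j))) * factor y (inj₁ (fromℕ m , j))
            ≡⟨ cong₂ _*_ (∏-cong m factor-inner) factor-last ⟩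
          ∏ m (c ∘ toℕ) * (c m * bottom)
            ≡⟨ *-assoc (∏ m (c ∘ toℕ)) (c m) bottom ⟨
          (∏ m (c ∘ toℕ) * c m) * bottom
            ≡⟨ cong (_* bottom) (sym (trans (∏-init-last m (c ∘ toℕ))
                 (cong₂ _*_ (∏-cong m (cong c ∘ toℕ-inject₁)) (cong c (toℕ-fromℕ m))))) ⟩
          ∏ (suc m) (c ∘ toℕ) * bottom
            ≡⟨ ∏-cell≡column (suc m) (xN j) (xS j) (marker t₁ j) (marker t₂ j) h ⟩
          column (xN j) (xS j) (marker t₁ j) (marker t₂ j) h (suc m) ∎
          where
          open ≡-Reasoning
          bottom = 𝟙 ⌊ wireAt t₁ t₂ j (suc m) Bool.≟ xS j ⌋

      factor-apex : ∀ c → factor y (inj₂ c) ≡ + 1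
      factor-apex c = HW=1-unit _ (pick c t₁ t₂) (λ t → apex t c)

      weight≡value : weightΓ y ≡ value (t₁ , t₂)
      weight≡value = begin
        weightΓ y
          ≡⟨ ∏ˢ-⊎ (finˢ (suc m) ×ˢ finˢ (suc m)) (finˢ 2) (factor y) ⟩
        ∏ˢ (finˢ (suc m) ×ˢ finˢ (suc m)) (factor y ∘ inj₁) * ∏ˢ (finˢ 2) (factor y ∘ inj₂)
          ≡⟨ cong₂ _*_ (∏ˢ-× (finˢ (suc m)) (finˢ (suc m)) (factor y ∘ inj₁)) (∏-one 2 factor-apex) ⟩
        ∏ (suc m) (λ i → ∏ (suc m) (λ j → factor y (inj₁ (i , j)))) * + 1
          ≡⟨ *-identityʳ _ ⟩
        ∏ (suc m) (λ i → ∏ (suc m) (λ j → factor y (inj₁ (i , j))))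
          ≡⟨ ∏-comm (suc m) (suc m) (λ i j → factor y (inj₁ (i , j))) ⟩
        ∏ (suc m) (λ j → ∏ (suc m) (λ i → factor y (inj₁ (i , j))))
          ≡⟨ ∏-cong (suc m) column-weight ⟩
        value (t₁ , t₂) ∎
        where open ≡-Reasoning

    Sig≡∑value : Sig (Γ (suc m) A) x ≡ ∑ˢ (finˢ L ×ˢ finˢ L) value
    Sig≡∑value = Sig≡∑-support (Γ (suc m) A) x (λ _ → refl) (finˢ L ×ˢ finˢ L) candidate value
      (λ y w≢0 → (Support.t₁ y w≢0 , Support.t₂ y w≢0) , Support.y≗candidate y w≢0)
      candidate-injective
      (λ { (t₁ , t₂) y y≗ → weight≡value t₁ t₂ y y≗ })

-- The signature of Γ↑(A)

toℕ≢n : ∀ {n} (i : Fin n) → toℕ i ≢ n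
toℕ≢n i eq = <-irrefl eq (toℕ<n i)

module GammaUpWeights {m : ℕ} (A : Pairs (suc m)) (A-unique : Unique A) (xN xE xS xW : Fin (suc m) → Bool) where
  open GammaUpDef (suc m) A

  x : Dir × Fin (suc m) → Bool
  x = assemble xN xE xS xW

  Config : Set
  Config = El Es → Bool

  edge : Config → Edge → Bool
  edge y = [ y , x ]

  factor : Config → El Vs → ℤ
  factor y v = VertexData.fun (vertex v) (edge y ∘ VertexData.inc (vertex v))

  -- an apex edge ends at a cell of A or at a dummy vertex (d = 0 top, d = 1 bottom)
  Option : Set
  Option = El apexInc

  _≟O_ : DecidableEquality Option
  _≟O_ = ⊎-≡-dec _≟_ (×-≡-dec _≟_ _≟_)

  row : Option → ℕ
  row (inj₁ t)             = suc (toℕ (proj₁ (lookup A t)))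
  row (inj₂ (zero  , j))   = 0
  row (inj₂ (suc _ , j))   = suc (suc m)

  col : Option → Fin (suc m)
  col (inj₁ t)       = proj₂ (lookup A t)
  col (inj₂ (_ , j)) = j

  position : Option → ℕ × Fin (suc m)
  position o = row o , col o

  position-injective : ∀ {o o′} → position o ≡ position o′ → o ≡ o′
  position-injective {inj₁ t} {inj₁ t′} eq = cong inj₁ (lookup-injective A-unique t t′
    (cong₂ _,_ (toℕ-injective (ℕ-suc-injective (cong proj₁ eq))) (cong proj₂ eq)))
  position-injective {inj₁ t} {inj₂ (zero , j)} ()
  position-injective {inj₁ t} {inj₂ (suc zero , j)} eq = contradiction (ℕ-suc-injective (cong proj₁ eq)) (toℕ≢n _)
  position-injective {inj₂ (zero , j)} {inj₁ t} ()
  position-injective {inj₂ (suc zero , j)} {inj₁ t} eq = contradiction (sym (ℕ-suc-injective (cong proj₁ eq))) (toℕ≢n _)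
  position-injective {inj₂ (zero , j)} {inj₂ (zero , j′)} refl = refl
  position-injective {inj₂ (suc zero , j)} {inj₂ (suc zero , j′)} refl = refl

  open Placement _≟O_ position position-injective public

  apexEdge : Option → Fin 2 → Edge
  apexEdge o c = [ (λ t → aE t c) , (λ dj → dE (proj₁ dj) (proj₂ dj) c) ] o

  wireAt : Option → Option → Fin (suc m) → ℕ → Bool
  wireAt c₁ c₂ j = wire (xN j) (flips (marker c₁ j) (marker c₂ j))

  ApexChoice : Config → Option → Option → Set
  ApexChoice y c₁ c₂ = ∀ o c → edge y (apexEdge o c) ≡ ⌊ o ≟O pick c c₁ c₂ ⌋

  factor-grid : ∀ y c₁ c₂ → ApexChoice y c₁ c₂ → ∀ i j →
                factor y (inj₁ (i , j)) ≡ pre (edge y (nE i j)) (edge y (eE i j)) (edge y (sE i j)) (edge y (wE i j))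
                                              (marks (marker c₁ j) (suc (toℕ i))) (marks (marker c₂ j) (suc (toℕ i)))
  factor-grid y c₁ c₂ apex i j with (i , j) ∈? A
  ... | yes p = cong₂ (pre _ _ _ _) (trans (apex (inj₁ (index p)) zero) (sym (marks-occupied _ c₁ at)))
                                    (trans (apex (inj₁ (index p)) (suc zero)) (sym (marks-occupied _ c₂ at)))
    where at = cong (Prod.map₁ (suc ∘ toℕ)) (sym (lookup-index p))
  ... | no  p∉ = sym (cong₂ (pre _ _ _ _) (marks-vacant c₁ vacant) (marks-vacant c₂ vacant))
    where vacant : ∀ o → position o ≢ (suc (toℕ i) , j)
          vacant (inj₁ t) eq =
            p∉ (subst (_∈ A) (cong₂ _,_ (toℕ-injective (ℕ-suc-injective (cong proj₁ eq))) (cong proj₂ eq)) (∈-lookup t))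
          vacant (inj₂ (suc zero , _)) eq = toℕ≢n i (sym (ℕ-suc-injective (cong proj₁ eq)))

  factor-top : ∀ y c₁ c₂ → ApexChoice y c₁ c₂ → ∀ j →
               factor y (inj₂ (inj₁ (zero , j))) ≡ pre (xN j) false (y (inj₁ (zero , j))) false
                                                       (marks (marker c₁ j) 0) (marks (marker c₂ j) 0)
  factor-top y c₁ c₂ apex j = cong₂ (pre _ _ _ _)
    (trans (apex (inj₂ (zero , j)) zero) (sym (marks-occupied _ c₁ refl)))
    (trans (apex (inj₂ (zero , j)) (suc zero)) (sym (marks-occupied _ c₂ refl)))

  factor-bottom : ∀ y c₁ c₂ → ApexChoice y c₁ c₂ → ∀ j →
                  factor y (inj₂ (inj₁ (suc zero , j))) ≡ pre (y (inj₁ (fromℕ (suc m) , j))) false (xS j) false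
                                                              (marks (marker c₁ j) (suc (suc m))) (marks (marker c₂ j) (suc (suc m)))
  factor-bottom y c₁ c₂ apex j = cong₂ (pre _ _ _ _)
    (trans (apex (inj₂ (suc zero , j)) zero) (sym (marks-occupied _ c₁ refl)))
    (trans (apex (inj₂ (suc zero , j)) (suc zero)) (sym (marks-occupied _ c₂ refl)))

  east-inner : ∀ y i k → edge y (eE i (inject₁ k)) ≡ y (inj₂ (inj₁ (i , k)))
  east-inner y i k rewrite after′-inject₁ k = refl

  east-last : ∀ y i → edge y (eE i (fromℕ m)) ≡ xE i
  east-last y i rewrite after′-last m = refl

  candidate : Option × Option → Config
  candidate (c₁ , c₂) (inj₁ (k , j))                     = wireAt c₁ c₂ j (suc (toℕ k))
  candidate (c₁ , c₂) (inj₂ (inj₁ (i , k)))              = xW i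
  candidate (c₁ , c₂) (inj₂ (inj₂ (inj₁ (t , c))))       = ⌊ inj₁ t ≟O pick c c₁ c₂ ⌋
  candidate (c₁ , c₂) (inj₂ (inj₂ (inj₂ ((d , j) , c)))) = ⌊ inj₂ (d , j) ≟O pick c c₁ c₂ ⌋

  weightΓ↑ : Config → ℤ
  weightΓ↑ = weight (Γ↑ (suc m) A) x (λ _ → refl)

  factor≢0 : ∀ y → weightΓ↑ y ≢ + 0 → ∀ v → factor y v ≢ + 0
  factor≢0 y w≢0 v f≡0 = w≢0 (∏-zero (size Vs) (factor y ∘ Inverse.to (enum Vs)) (Inverse.from (enum Vs) v)
    (subst (λ v′ → factor y v′ ≡ + 0) (sym (Inverse.strictlyInverseˡ (enum Vs) v)) f≡0))

  module Support (y : Config) (w≢0 : weightΓ↑ y ≢ + 0) where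
    chosen : ∀ c → ∃ λ k → (λ k′ → edge y (apexEdge (Inverse.to (enum apexInc) k′) c)) ≗ unit k
    chosen c = hw≡1⇒unit apexEdges (HW=1≢0 apexEdges (factor≢0 y w≢0 (inj₂ (inj₂ c))))
      where apexEdges = λ k′ → edge y (apexEdge (Inverse.to (enum apexInc) k′) c)

    choice : Fin 2 → Option
    choice c = Inverse.to (enum apexInc) (proj₁ (chosen c))

    c₁ c₂ : Option
    c₁ = choice zero
    c₂ = choice (suc zero)

    apex-choice : ∀ o c → edge y (apexEdge o c) ≡ ⌊ o ≟O choice c ⌋
    apex-choice o c = begin
      edge y (apexEdge o c)
        ≡⟨ cong (λ o′ → edge y (apexEdge o′ c)) (Inverse.strictlyInverseˡ (enum apexInc) o) ⟨
      edge y (apexEdge (Inverse.to (enum apexInc) (Inverse.from (enum apexInc) o)) c)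
        ≡⟨ proj₂ (chosen c) _ ⟩
      unit (proj₁ (chosen c)) (Inverse.from (enum apexInc) o)
        ≡⟨ ⌊⌋-⇔ (λ e → trans (sym (Inverse.strictlyInverseˡ (enum apexInc) o)) (cong (Inverse.to (enum apexInc)) e))
                (λ e → trans (cong (Inverse.from (enum apexInc)) e) (Inverse.strictlyInverseʳ (enum apexInc) _)) _ _ ⟩
      ⌊ o ≟O choice c ⌋ ∎
      where open ≡-Reasoning

    apex : ApexChoice y c₁ c₂
    apex o zero       = apex-choice o zero
    apex o (suc zero) = apex-choice o (suc zero)

    local : ∀ i j → edge y (sE i j) ≡ edge y (nE i j) xor flips (marker c₁ j) (marker c₂ j) (suc (toℕ i))
                  × edge y (eE i j) ≡ edge y (wE i j)
    local i j = pre-support (edge y (nE i j)) (edge y (eE i j)) (edge y (sE i j)) (edge y (wE i j))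
                            (marks (marker c₁ j) (suc (toℕ i))) (marks (marker c₂ j) (suc (toℕ i)))
                            (λ pre≡0 → factor≢0 y w≢0 (inj₁ (i , j)) (trans (factor-grid y c₁ c₂ apex i j) pre≡0))

    top : ∀ j → y (inj₁ (zero , j)) ≡ wireAt c₁ c₂ j 1
    top j = proj₁ (pre-support (xN j) false (y (inj₁ (zero , j))) false (marks (marker c₁ j) 0) (marks (marker c₂ j) 0)
                   (λ pre≡0 → factor≢0 y w≢0 (inj₂ (inj₁ (zero , j))) (trans (factor-top y c₁ c₂ apex j) pre≡0)))

    west-edge : ∀ i j → edge y (wE i j) ≡ xW i
    west-edge i = <-weakInduction (λ j → edge y (wE i j) ≡ xW i) refl
      (λ k w≡ → trans (sym (east-inner y i k)) (trans (proj₂ (local i (inject₁ k))) w≡))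

    vertical : ∀ j k → y (inj₁ (k , j)) ≡ wireAt c₁ c₂ j (suc (toℕ k))
    vertical j = <-weakInduction (λ k → y (inj₁ (k , j)) ≡ wireAt c₁ c₂ j (suc (toℕ k))) (top j)
      (λ k v≡ → trans (proj₁ (local k j))
        (cong (_xor flips (marker c₁ j) (marker c₂ j) (suc (toℕ k))) (trans v≡ (cong (wireAt c₁ c₂ j ∘ suc) (toℕ-inject₁ k)))))

    east≡west : ∀ i → xE i ≡ xW i
    east≡west i = trans (sym (east-last y i)) (trans (proj₂ (local i (fromℕ m))) (west-edge i (fromℕ m)))

    y≗candidate : y ≗ candidate (c₁ , c₂)
    y≗candidate (inj₁ (k , j))                     = vertical j k
    y≗candidate (inj₂ (inj₁ (i , k)))              = west-edge i (suc k)
    y≗candidate (inj₂ (inj₂ (inj₁ (t , c))))       = apex (inj₁ t) c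
    y≗candidate (inj₂ (inj₂ (inj₂ ((d , j) , c)))) = apex (inj₂ (d , j)) c

  candidate-injective : ∀ c c′ y → y ≗ candidate c → y ≗ candidate c′ → c ≡ c′
  candidate-injective (c₁ , c₂) (c₁′ , c₂′) y y≗c y≗c′ = cong₂ _,_ (same zero) (same (suc zero))
    where
    apexE : Option → Fin 2 → El Es
    apexE (inj₁ t)  c = inj₂ (inj₂ (inj₁ (t , c)))
    apexE (inj₂ dj) c = inj₂ (inj₂ (inj₂ (dj , c)))
    at-apex : ∀ c₁ c₂ o c → candidate (c₁ , c₂) (apexE o c) ≡ ⌊ o ≟O pick c c₁ c₂ ⌋
    at-apex c₁ c₂ (inj₁ t)  c = refl
    at-apex c₁ c₂ (inj₂ dj) c = refl
    same : ∀ c → pick c c₁ c₂ ≡ pick c c₁′ c₂′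
    same c = ⌊⌋-true⇒ (o ≟O pick c c₁′ c₂′)
      (trans (sym (at-apex c₁′ c₂′ o c)) (trans (sym (y≗c′ (apexE o c)))
        (trans (y≗c (apexE o c)) (trans (at-apex c₁ c₂ o c) (⌊⌋-yes (o ≟O o) refl)))))
      where o = pick c c₁ c₂

  Sig≡0 : ¬ (∀ i → xE i ≡ xW i) → Sig (Γ↑ (suc m) A) x ≡ + 0
  Sig≡0 ¬east≡west = Sig-vanishing (Γ↑ (suc m) A) x (λ _ → refl) λ y → case (weightΓ↑ y ℤ.≟ + 0)
    where
    case : ∀ {y} → Dec (weightΓ↑ y ≡ + 0) → weightΓ↑ y ≡ + 0
    case (yes w≡0)    = w≡0
    case {y} (no w≢0) = contradiction (Support.east≡west y w≢0) ¬east≡west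

  module Evaluation (u : Fin (suc m)) (xW≗u : xW ≗ unit u) (east≡west : ∀ i → xE i ≡ xW i) where
    h : Maybe ℕ
    h = just (suc (toℕ u))

    h-bottom : marks h (suc (suc m)) ≡ false
    h-bottom = trans (sym (isYes≗does (toℕ u ℕ.≟ suc m))) (⌊⌋-no (toℕ u ℕ.≟ suc m) (toℕ≢n u))

    value : Option × Option → ℤ
    value (c₁ , c₂) = ∏ (suc m) (λ j → column (xN j) (xS j) (marker c₁ j) (marker c₂ j) h (suc (suc (suc m))))

    module _ (c₁ c₂ : Option) (y : Config) (y≗ : y ≗ candidate (c₁ , c₂)) where
      apex : ApexChoice y c₁ c₂
      apex (inj₁ t)  c = y≗ (inj₂ (inj₂ (inj₁ (t , c))))
      apex (inj₂ dj) c = y≗ (inj₂ (inj₂ (inj₂ (dj , c))))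

      west-edge : ∀ i j → edge y (wE i j) ≡ marks h (suc (toℕ i))
      west-edge i zero    = trans (xW≗u i) (sym (marks-toℕ u i))
      west-edge i (suc k) = trans (y≗ _) (trans (xW≗u i) (sym (marks-toℕ u i)))

      east-edge : ∀ i j → edge y (eE i j) ≡ marks h (suc (toℕ i))
      east-edge i j with after j
      ... | just k  = trans (y≗ _) (trans (xW≗u i) (sym (marks-toℕ u i)))
      ... | nothing = trans (east≡west i) (trans (xW≗u i) (sym (marks-toℕ u i)))

      module _ (j : Fin (suc m)) where
        c : ℕ → ℤ
        c = cell (xN j) (marker c₁ j) (marker c₂ j) h

        factor-top-cell : factor y (inj₂ (inj₁ (zero , j))) ≡ c 0
        factor-top-cell = trans (factor-top y c₁ c₂ apex j)
          (cong (λ s → pre (xN j) false s false (marks (marker c₁ j) 0) (marks (marker c₂ j) 0)) (y≗ _))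

        factor-grid-cell : ∀ i → factor y (inj₁ (i , j)) ≡ c (suc (toℕ i))
        factor-grid-cell i = trans (factor-grid y c₁ c₂ apex i j)
          (pre-cong (trans (y≗ _) (cong (wireAt c₁ c₂ j ∘ suc) (toℕ-inject₁ i))) (east-edge i j) (y≗ _) (west-edge i j)
                    (refl {x = marks (marker c₁ j) (suc (toℕ i))}) (refl {x = marks (marker c₂ j) (suc (toℕ i))}))

        factor-bottom-cell : factor y (inj₂ (inj₁ (suc zero , j))) ≡ c (suc (suc m)) * 𝟙 ⌊ wireAt c₁ c₂ j (suc (suc (suc m))) Bool.≟ xS j ⌋
        factor-bottom-cell = trans (factor-bottom y c₁ c₂ apex j)
          (trans (pre-cong (trans (y≗ _) (cong (wireAt c₁ c₂ j ∘ suc) (toℕ-fromℕ (suc m)))) (sym h-bottom)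
                           (refl {x = xS j}) (sym h-bottom) (refl {x = a}) (refl {x = b}))
                 (pre-south (wireAt c₁ c₂ j r) (marks h r) (xS j) (marks h r) a b))
          where r = suc (suc m)
                a = marks (marker c₁ j) r
                b = marks (marker c₂ j) r

        column-weight : factor y (inj₂ (inj₁ (zero , j))) * (∏ (suc m) (λ i → factor y (inj₁ (i , j))) * factor y (inj₂ (inj₁ (suc zero , j))))
                      ≡ column (xN j) (xS j) (marker c₁ j) (marker c₂ j) h (suc (suc (suc m)))
        column-weight = begin
          factor y (inj₂ (inj₁ (zero , j))) * (∏ (suc m) (λ i → factor y (inj₁ (i , j))) * factor y (inj₂ (inj₁ (suc zero , j))))
            ≡⟨ cong₂ _*_ factor-top-cell (cong₂ _*_ (∏-cong (suc m) factor-grid-cell) factor-bottom-cell) ⟩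
          c 0 * (∏ (suc m) (c ∘ suc ∘ toℕ) * (c (suc (suc m)) * bottom))
            ≡⟨ cong (c 0 *_) (*-assoc (∏ (suc m) (c ∘ suc ∘ toℕ)) (c (suc (suc m))) bottom) ⟨
          c 0 * ((∏ (suc m) (c ∘ suc ∘ toℕ) * c (suc (suc m))) * bottom)
            ≡⟨ cong (λ p → c 0 * (p * bottom)) (sym (trans (∏-init-last (suc m) (c ∘ suc ∘ toℕ))
                 (cong₂ _*_ (∏-cong (suc m) (cong (c ∘ suc) ∘ toℕ-inject₁)) (cong (c ∘ suc) (toℕ-fromℕ (suc m)))))) ⟩
          c 0 * (∏ (suc (suc m)) (c ∘ suc ∘ toℕ) * bottom)
            ≡⟨ *-assoc (c 0) (∏ (suc (suc m)) (c ∘ suc ∘ toℕ)) bottom ⟨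
          ∏ (suc (suc (suc m))) (c ∘ toℕ) * bottom
            ≡⟨ ∏-cell≡column (suc (suc (suc m))) (xN j) (xS j) (marker c₁ j) (marker c₂ j) h ⟩
          column (xN j) (xS j) (marker c₁ j) (marker c₂ j) h (suc (suc (suc m))) ∎
          where
          open ≡-Reasoning
          bottom = 𝟙 ⌊ wireAt c₁ c₂ j (suc (suc (suc m))) Bool.≟ xS j ⌋

      factor-apex : ∀ c → factor y (inj₂ (inj₂ c)) ≡ + 1
      factor-apex c = HW=1-unit _ (from (pick c c₁ c₂)) λ k → trans (apex (to k) c)
        (⌊⌋-⇔ (λ e → trans (sym (Inverse.strictlyInverseʳ (enum apexInc) k)) (cong from e))
              (λ e → trans (cong to e) (Inverse.strictlyInverseˡ (enum apexInc) _)) _ _)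
        where
        to   = Inverse.to (enum apexInc)
        from = Inverse.from (enum apexInc)

      weight≡value : weightΓ↑ y ≡ value (c₁ , c₂)
      weight≡value = begin
        weightΓ↑ y
          ≡⟨ ∏ˢ-⊎ (finˢ (suc m) ×ˢ finˢ (suc m)) ((finˢ 2 ×ˢ finˢ (suc m)) ⊎ˢ finˢ 2) (factor y) ⟩
        ∏ˢ (finˢ (suc m) ×ˢ finˢ (suc m)) (factor y ∘ inj₁) * ∏ˢ ((finˢ 2 ×ˢ finˢ (suc m)) ⊎ˢ finˢ 2) (factor y ∘ inj₂)
          ≡⟨ cong₂ _*_ (trans (∏ˢ-× (finˢ (suc m)) (finˢ (suc m)) (factor y ∘ inj₁)) (∏-comm (suc m) (suc m) (λ i j → Grid j i)))
                       (trans (∏ˢ-⊎ (finˢ 2 ×ˢ finˢ (suc m)) (finˢ 2) (factor y ∘ inj₂))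
                              (cong₂ _*_ (∏ˢ-× (finˢ 2) (finˢ (suc m)) (factor y ∘ inj₂ ∘ inj₁)) (∏-one 2 factor-apex))) ⟩
        ∏ (suc m) (λ j → ∏ (suc m) (Grid j)) * ((∏ (suc m) Top * (∏ (suc m) Bot * + 1)) * + 1)
          ≡⟨ rearrange (∏ (suc m) (λ j → ∏ (suc m) (Grid j))) (∏ (suc m) Top) (∏ (suc m) Bot) ⟩
        ∏ (suc m) Top * (∏ (suc m) (λ j → ∏ (suc m) (Grid j)) * ∏ (suc m) Bot)
          ≡⟨ cong (∏ (suc m) Top *_) (∏-distrib-* (suc m) (λ j → ∏ (suc m) (Grid j)) Bot) ⟨
        ∏ (suc m) Top * ∏ (suc m) (λ j → ∏ (suc m) (Grid j) * Bot j)
          ≡⟨ ∏-distrib-* (suc m) Top (λ j → ∏ (suc m) (Grid j) * Bot j) ⟨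
        ∏ (suc m) (λ j → Top j * (∏ (suc m) (Grid j) * Bot j))
          ≡⟨ ∏-cong (suc m) column-weight ⟩
        value (c₁ , c₂) ∎
        where
        open ≡-Reasoning
        Grid : Fin (suc m) → Fin (suc m) → ℤ
        Grid j i = factor y (inj₁ (i , j))
        Top Bot : Fin (suc m) → ℤ
        Top j = factor y (inj₂ (inj₁ (zero , j)))
        Bot j = factor y (inj₂ (inj₁ (suc zero , j)))
        rearrange : ∀ g t b → g * ((t * (b * + 1)) * + 1) ≡ t * (g * b)
        rearrange = solve-∀

    Sig≡∑value : Sig (Γ↑ (suc m) A) x ≡ ∑ˢ (apexInc ×ˢ apexInc) value
    Sig≡∑value = Sig≡∑-support (Γ↑ (suc m) A) x (λ _ → refl) (apexInc ×ˢ apexInc) candidate value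
      (λ y w≢0 → (Support.c₁ y w≢0 , Support.c₂ y w≢0) , Support.y≗candidate y w≢0)
      candidate-injective
      (λ { (c₁ , c₂) y y≗ → weight≡value c₁ c₂ y y≗ })

-- The difference of the two signatures

<ᵇ-suc : ∀ a b → (a <ᵇ b) ≡ true → (a <ᵇ suc b) ≡ true
<ᵇ-suc zero    b       _ = refl
<ᵇ-suc (suc a) (suc b) e = <ᵇ-suc a b e

n<ᵇsuc-n : ∀ n → (n <ᵇ suc n) ≡ true
n<ᵇsuc-n zero    = refl
n<ᵇsuc-n (suc n) = n<ᵇsuc-n n

toℕ<ᵇn : ∀ {n} (i : Fin n) → (toℕ i <ᵇ n) ≡ true
toℕ<ᵇn {suc n} zero    = refl
toℕ<ᵇn {suc n} (suc i) = toℕ<ᵇn i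

n≮ᵇtoℕ : ∀ {n} (i : Fin n) → (n <ᵇ toℕ i) ≡ false
n≮ᵇtoℕ {suc n} zero    = refl
n≮ᵇtoℕ {suc n} (suc i) = n≮ᵇtoℕ i

toℕ≢ᵇn : ∀ {n} (i : Fin n) → (toℕ i ≡ᵇ n) ≡ false
toℕ≢ᵇn {suc n} zero    = refl
toℕ≢ᵇn {suc n} (suc i) = toℕ≢ᵇn i

sign-sum : ∀ a b → sign (a <ᵇ b) + sign (b <ᵇ a) ≡ (if a ≡ᵇ b then + 2 else + 0)
sign-sum zero    zero    = refl
sign-sum zero    (suc b) = refl
sign-sum (suc a) zero    = refl
sign-sum (suc a) (suc b) = sign-sum a b

∑-𝟙≡hw : ∀ k (z : Fin k → Bool) → ∑ k (𝟙 ∘ z) ≡ + hw z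
∑-𝟙≡hw zero    z = refl
∑-𝟙≡hw (suc k) z with z zero
... | true  = cong (_+_ (+ 1)) (∑-𝟙≡hw k (z ∘ suc))
... | false = trans (+-identityˡ _) (∑-𝟙≡hw k (z ∘ suc))

𝟙*≢0 : ∀ b (z : ℤ) → 𝟙 b * z ≢ + 0 → b ≡ true
𝟙*≢0 true  z _   = refl
𝟙*≢0 false z 0≢0 = contradiction refl 0≢0

∑-lookup : ∀ {n} (A : Pairs n) → Unique A → (g : Fin n × Fin n → ℤ) →
           ∑ (length A) (g ∘ lookup A) ≡ ∑ n (λ i → ∑ n (λ j → 𝟙 ⌊ (i , j) ∈? A ⌋ * g (i , j)))
∑-lookup {n} []      []        g = sym (∑-zero n (λ i → ∑-zero n (λ j → refl)))
∑-lookup {n} (τ ∷ A) (τ∉ ∷ uA) g = begin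
  g τ + ∑ (length A) (g ∘ lookup A)
    ≡⟨ cong₂ _+_ (sym single) (∑-lookup A uA g) ⟩
  ∑ n (λ i → ∑ n (λ j → 𝟙 ⌊ (i , j) ≟² τ ⌋ * g (i , j))) + ∑ n (λ i → ∑ n (λ j → 𝟙 ⌊ (i , j) ∈? A ⌋ * g (i , j)))
    ≡⟨ trans (∑-cong n (λ i → ∑-distrib-+ n _ _)) (∑-distrib-+ n _ _) ⟨
  ∑ n (λ i → ∑ n (λ j → 𝟙 ⌊ (i , j) ≟² τ ⌋ * g (i , j) + 𝟙 ⌊ (i , j) ∈? A ⌋ * g (i , j)))
    ≡⟨ ∑-cong n (λ i → ∑-cong n (λ j → trans (sym (*-distribʳ-+ (g (i , j)) (𝟙 ⌊ (i , j) ≟² τ ⌋) (𝟙 ⌊ (i , j) ∈? A ⌋)))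
                                             (cong (_* g (i , j)) (𝟙-cons (i , j))))) ⟩
  ∑ n (λ i → ∑ n (λ j → 𝟙 ⌊ (i , j) ∈? (τ ∷ A) ⌋ * g (i , j))) ∎
  where
  open ≡-Reasoning
  _≟²_ : (p q : Fin n × Fin n) → Dec (p ≡ q)
  _≟²_ = ×-≡-dec _≟_ _≟_
  τ∉A : τ ∉ A
  τ∉A τ∈A = All.lookup τ∉ τ∈A refl
  𝟙-cons : ∀ σ → 𝟙 ⌊ σ ≟² τ ⌋ + 𝟙 ⌊ σ ∈? A ⌋ ≡ 𝟙 ⌊ σ ∈? (τ ∷ A) ⌋
  𝟙-cons σ = by-cases (σ ≟² τ)
    where
    by-cases : (d : Dec (σ ≡ τ)) → 𝟙 ⌊ d ⌋ + 𝟙 ⌊ σ ∈? A ⌋ ≡ 𝟙 ⌊ σ ∈? (τ ∷ A) ⌋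
    by-cases (yes refl) = trans (cong (λ b → + 1 + 𝟙 b) (⌊⌋-no (τ ∈? A) τ∉A)) (cong 𝟙 (sym (⌊⌋-yes (τ ∈? (τ ∷ A)) (here refl))))
    by-cases (no  σ≢τ)  = trans (+-identityˡ _)
      (cong 𝟙 (⌊⌋-⇔ there (λ { (here σ≡τ) → contradiction σ≡τ σ≢τ ; (there σ∈A) → σ∈A }) (σ ∈? A) (σ ∈? (τ ∷ A))))
  single : ∑ n (λ i → ∑ n (λ j → 𝟙 ⌊ (i , j) ≟² τ ⌋ * g (i , j))) ≡ g τ
  single = begin
    ∑ n (λ i → ∑ n (λ j → 𝟙 ⌊ (i , j) ≟² τ ⌋ * g (i , j)))
      ≡⟨ ∑-single n _ (proj₁ τ) (λ i i≢ → ∑-zero n (λ j → off (i , j) (i≢ ∘ cong proj₁))) ⟩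
    ∑ n (λ j → 𝟙 ⌊ (proj₁ τ , j) ≟² τ ⌋ * g (proj₁ τ , j))
      ≡⟨ ∑-single n _ (proj₂ τ) (λ j j≢ → off (proj₁ τ , j) (j≢ ∘ cong proj₂)) ⟩
    𝟙 ⌊ τ ≟² τ ⌋ * g τ
      ≡⟨ cong (λ b → 𝟙 b * g τ) (⌊⌋-yes (τ ≟² τ) refl) ⟩
    + 1 * g τ
      ≡⟨ *-identityˡ (g τ) ⟩
    g τ ∎
    where
    off : ∀ σ → σ ≢ τ → 𝟙 ⌊ σ ≟² τ ⌋ * g σ ≡ + 0
    off σ σ≢τ = cong (λ b → 𝟙 b * g σ) (⌊⌋-no (σ ≟² τ) σ≢τ)

-- T counts the cells of A in the row u of the horizontal wire, and b says whether (u , v) ∈ A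
excessValue : ℕ → ℕ → Bool → ℤ
excessValue n T b = (-[1+ 1 ] * + T + + 4 * 𝟙 b) + (+ n * + 1 + -[1+ 1 ])

excessValue-∉ : ∀ n T → excessValue n T Bool.false ≡ + n - + (2 ℕ.* T) - + 2
excessValue-∉ n T rewrite pos-* 2 T = arithmetic (+ n) (+ T)
  where
  arithmetic : ∀ (n T : ℤ) → (-[1+ 1 ] * T + + 4 * + 0) + (n * + 1 + -[1+ 1 ]) ≡ n - + 2 * T - + 2
  arithmetic = solve-∀

excessValue-∈ : ∀ n T → excessValue n T Bool.true ≡ + n - + (2 ℕ.* T) + + 2
excessValue-∈ n T rewrite pos-* 2 T = arithmetic (+ n) (+ T)
  where
  arithmetic : ∀ (n T : ℤ) → (-[1+ 1 ] * T + + 4 * + 1) + (n * + 1 + -[1+ 1 ]) ≡ n - + 2 * T + + 2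
  arithmetic = solve-∀

module Difference {m : ℕ} (A : Pairs (suc m)) (A-unique : Unique A) (xN xE xS xW : Fin (suc m) → Bool)
                  (u : Fin (suc m)) (xW≗u : xW ≗ unit u) (east≡west : ∀ i → xE i ≡ xW i) where
  private
    n : ℕ
    n = suc m
  module G  = GammaWeights A A-unique xN xE xS xW
  module G↑ = GammaUpWeights A A-unique xN xE xS xW
  open G↑ using (Option; row; col)
  open GammaUpDef n A using (apexInc; L)

  h : Maybe ℕ
  h = just (suc (toℕ u))

  colValue : Option → Option → Fin n → ℤ
  colValue c₁ c₂ k = column (xN k) (xS k) (G↑.marker c₁ k) (G↑.marker c₂ k) h (suc (suc n))

  value : Option → Option → ℤ
  value c₁ c₂ = ∏ n (colValue c₁ c₂)

  unmarked : Fin n → ℤ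
  unmarked k = column (xN k) (xS k) nothing nothing h (suc (suc n))

  -- the value of a configuration whose two markers both lie in column j and cancel each other
  weightAt : Fin n → ℤ
  weightAt j = 𝟙 ⌊ xN j Bool.≟ xS j ⌋ * ∏ n (omit j unmarked)

  top bottom : Fin n → Option
  top    j = inj₂ (zero , j)
  bottom j = inj₂ (suc zero , j)

  marker-here : ∀ c → G↑.marker c (col c) ≡ just (row c)
  marker-here c = markerAt-here (row c) (col c)

  marker-elsewhere : ∀ c k → k ≢ col c → G↑.marker c k ≡ nothing
  marker-elsewhere c k k≢ = markerAt-elsewhere (row c) (k≢ ∘ sym)

  value-in-column : ∀ c₁ c₂ j → col c₁ ≡ j → col c₂ ≡ j → value c₁ c₂ ≡ colValue c₁ c₂ j * ∏ n (omit j unmarked)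
  value-in-column c₁ c₂ j c₁-in c₂-in = ∏-omit n (colValue c₁ c₂) unmarked j λ k k≢j →
    cong₂ (λ a b → column (xN k) (xS k) a b h (suc (suc n)))
          (marker-elsewhere c₁ k (λ k≡ → k≢j (trans k≡ c₁-in))) (marker-elsewhere c₂ k (λ k≡ → k≢j (trans k≡ c₂-in)))

  -- the sign picked up when the second marker runs over the dummies of the first marker's column
  dummySign : Option → ℤ
  dummySign (inj₁ t)           = sign (toℕ (proj₁ (lookup A t)) <ᵇ toℕ u)
  dummySign (inj₂ (zero , _))  = -[1+ 0 ]
  dummySign (inj₂ (suc _ , _)) = + 0

  private
    u<n : (toℕ u <ᵇ n) ≡ true
    u<n = toℕ<ᵇn u
    u<suc-n : (toℕ u <ᵇ suc n) ≡ true
    u<suc-n = <ᵇ-suc (toℕ u) n u<n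
    n≮u : (n <ᵇ toℕ u) ≡ false
    n≮u = n≮ᵇtoℕ u
    last<N′ : (suc n <ᵇ suc (suc n)) ≡ true
    last<N′ = n<ᵇsuc-n (suc n)

    agree-split : ∀ x xs s → 𝟙 (x ∧ xs) * s + 𝟙 (not x ∧ not xs) * s ≡ 𝟙 ⌊ x Bool.≟ xs ⌋ * s
    agree-split true  true  s = +-identityʳ (+ 1 * s)
    agree-split true  false s = refl
    agree-split false true  s = refl
    agree-split false false s = +-identityˡ (+ 1 * s)

  pair-in-column₁ : ∀ c₁ → let j = col c₁ in
    colValue c₁ (top j) j + colValue c₁ (bottom j) j ≡ 𝟙 ⌊ xN j Bool.≟ xS j ⌋ * dummySign c₁
  pair-in-column₁ c₁ rewrite marker-here c₁ | marker-here (top (col c₁)) | marker-here (bottom (col c₁)) = by-kind c₁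
    where
    by-kind : ∀ c₁ → let j = col c₁ in
         column (xN j) (xS j) (just (row c₁)) (just 0) h (suc (suc n))
         + column (xN j) (xS j) (just (row c₁)) (just (suc n)) h (suc (suc n)) ≡ 𝟙 ⌊ xN j Bool.≟ xS j ⌋ * dummySign c₁
    by-kind (inj₁ t) = trans (cong₂ _+_ (column-marked₂<₁ (suc (suc n)) (suc r) 0 x xs h refl (<ᵇ-suc r n (toℕ<ᵇn i)))
                                   (column-marked₁<₂ (suc (suc n)) (suc r) (suc n) x xs h (toℕ<ᵇn i) last<N′))
                        (trans (cong₂ (λ a b → 𝟙 (x ∧ xs) * sign ((r <ᵇ toℕ u) ∧ a) + 𝟙 (not x ∧ not xs) * sign ((r <ᵇ toℕ u) ∧ b)) u<suc-n u<n)
                               (trans (cong (λ s → 𝟙 (x ∧ xs) * sign s + 𝟙 (not x ∧ not xs) * sign s) (∧-identityʳ _)) (agree-split x xs _)))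
      where
      i = proj₁ (lookup A t)
      r = toℕ i
      x = xN (col (inj₁ t))
      xs = xS (col (inj₁ t))
    by-kind (inj₂ (zero , j)) =
      trans (cong₂ _+_ (column-marked-twice (suc (suc n)) 0 (xN j) (xS j) h refl)
                       (column-marked₁<₂ (suc (suc n)) 0 (suc n) (xN j) (xS j) h refl last<N′))
            (trans (cong₂ (λ a b → 𝟙 (xN j ∧ xS j) * sign a + 𝟙 (not (xN j) ∧ not (xS j)) * sign b) u<suc-n u<n)
                   (agree-split (xN j) (xS j) (sign true)))
    by-kind (inj₂ (suc zero , j)) =
      trans (cong₂ _+_ (column-marked₂<₁ (suc (suc n)) (suc n) 0 (xN j) (xS j) h refl last<N′)
                       (column-marked-twice (suc (suc n)) (suc n) (xN j) (xS j) h last<N′))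
            (trans (cong₂ (λ a b → 𝟙 (xN j ∧ xS j) * sign (a ∧ (toℕ u <ᵇ suc n)) + 𝟙 (xN j ∧ xS j) * sign (not b ∧ (toℕ u <ᵇ suc n)))
                          n≮u (toℕ≢ᵇn u))
                   (trans (cong (λ c → 𝟙 (xN j ∧ xS j) * sign false + 𝟙 (xN j ∧ xS j) * sign c) u<suc-n)
                          (cancel-split (xN j) (xS j))))
      where
      cancel-split : ∀ x xs → 𝟙 (x ∧ xs) * sign false + 𝟙 (x ∧ xs) * sign true ≡ 𝟙 ⌊ x Bool.≟ xs ⌋ * + 0
      cancel-split true  true  = refl
      cancel-split true  false = refl
      cancel-split false true  = refl
      cancel-split false false = refl

  pair-in-column₂ : ∀ t → let j = col (inj₁ t) in
    colValue (top j) (inj₁ t) j + colValue (bottom j) (inj₁ t) j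
      ≡ 𝟙 ⌊ xN j Bool.≟ xS j ⌋ * sign (toℕ u <ᵇ toℕ (proj₁ (lookup A t)))
  pair-in-column₂ t rewrite marker-here (inj₁ t) | marker-here (top (col (inj₁ t))) | marker-here (bottom (col (inj₁ t))) =
    trans (cong₂ _+_ (column-marked₁<₂ (suc (suc n)) 0 (suc r) x xs h refl (<ᵇ-suc r n (toℕ<ᵇn i)))
                     (column-marked₂<₁ (suc (suc n)) (suc n) (suc r) x xs h (toℕ<ᵇn i) last<N′))
          (trans (cong (λ a → 𝟙 (not x ∧ not xs) * sign (toℕ u <ᵇ r) + 𝟙 (x ∧ xs) * sign ((toℕ u <ᵇ r) ∨ (a ∧ (toℕ u <ᵇ suc n)))) n≮u)
          (trans (cong (λ s → 𝟙 (not x ∧ not xs) * sign (toℕ u <ᵇ r) + 𝟙 (x ∧ xs) * sign s) (∨-identityʳ _))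
          (trans (+-comm (𝟙 (not x ∧ not xs) * sign (toℕ u <ᵇ r)) _) (agree-split x xs _))))
    where
    i = proj₁ (lookup A t)
    r = toℕ i
    x = xN (col (inj₁ t))
    xs = xS (col (inj₁ t))

  private
    flip-sign : ∀ b s → 𝟙 b * sign s ≡ - (𝟙 b * sign (not s))
    flip-sign true  true  = refl
    flip-sign true  false = refl
    flip-sign false true  = refl
    flip-sign false false = refl

    unmarked-elsewhere : ∀ c₁ c₂ c₂′ j → col c₂ ≡ j → col c₂′ ≡ j → ∀ k → k ≢ j → colValue c₁ c₂ k ≡ colValue c₁ c₂′ k
    unmarked-elsewhere c₁ c₂ c₂′ j c₂-in c₂′-in k k≢j = cong (λ a → column (xN k) (xS k) (G↑.marker c₁ k) a h (suc (suc n)))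
      (trans (marker-elsewhere c₂ k (λ k≡ → k≢j (trans k≡ c₂-in))) (sym (marker-elsewhere c₂′ k (λ k≡ → k≢j (trans k≡ c₂′-in)))))

    unmarked-elsewhere′ : ∀ c₁ c₁′ c₂ j → col c₁ ≡ j → col c₁′ ≡ j → ∀ k → k ≢ j → colValue c₁ c₂ k ≡ colValue c₁′ c₂ k
    unmarked-elsewhere′ c₁ c₁′ c₂ j c₁-in c₁′-in k k≢j = cong (λ a → column (xN k) (xS k) a (G↑.marker c₂ k) h (suc (suc n)))
      (trans (marker-elsewhere c₁ k (λ k≡ → k≢j (trans k≡ c₁-in))) (sym (marker-elsewhere c₁′ k (λ k≡ → k≢j (trans k≡ c₁′-in)))))

  -- Off the first marker's column, moving the second marker from the top to the bottom dummy only changes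
  -- whether the horizontal wire meets the marked wire in that column, which flips its sign.
  dummies-cancel₂ : ∀ c₁ j → j ≢ col c₁ → value c₁ (top j) + value c₁ (bottom j) ≡ + 0
  dummies-cancel₂ c₁ j j≢ = ∏-opposite n (colValue c₁ (top j)) (colValue c₁ (bottom j)) j
    (unmarked-elsewhere c₁ (top j) (bottom j) j refl refl) at
    where
    at : colValue c₁ (top j) j ≡ - colValue c₁ (bottom j) j
    at rewrite marker-elsewhere c₁ j j≢ | marker-here (top j) | marker-here (bottom j) =
      trans (column-marked₂ (suc (suc n)) 0 (xN j) (xS j) h refl)
      (trans (flip-sign (xN j ∧ not (xS j)) false)
      (trans (cong (λ s → - (𝟙 (xN j ∧ not (xS j)) * sign s)) (sym u<n))
             (cong -_ (sym (column-marked₂ (suc (suc n)) (suc n) (xN j) (xS j) h last<N′)))))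

  dummies-cancel₁ : ∀ t j → j ≢ col (inj₁ t) → value (top j) (inj₁ t) + value (bottom j) (inj₁ t) ≡ + 0
  dummies-cancel₁ t j j≢ = ∏-opposite n (colValue (top j) (inj₁ t)) (colValue (bottom j) (inj₁ t)) j
    (unmarked-elsewhere′ (top j) (bottom j) (inj₁ t) j refl refl) at
    where
    at : colValue (top j) (inj₁ t) j ≡ - colValue (bottom j) (inj₁ t) j
    at rewrite marker-elsewhere (inj₁ t) j j≢ | marker-here (top j) | marker-here (bottom j) =
      trans (column-marked₁ (suc (suc n)) 0 (xN j) (xS j) h refl)
      (trans (cong (λ s → 𝟙 (not (xN j) ∧ xS j) * sign s) u<suc-n)
      (trans (flip-sign (not (xN j) ∧ xS j) true)
      (trans (cong (λ s → - (𝟙 (not (xN j) ∧ xS j) * sign (s ∧ (toℕ u <ᵇ suc n)))) (sym n≮u))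
             (cong -_ (sym (column-marked₁ (suc (suc n)) (suc n) (xN j) (xS j) h last<N′))))))

  sum-with-dummies₂ : ∀ c₁ → ∑ n (λ j → value c₁ (top j) + value c₁ (bottom j)) ≡ weightAt (col c₁) * dummySign c₁
  sum-with-dummies₂ c₁ = begin
    ∑ n (λ j → value c₁ (top j) + value c₁ (bottom j))
      ≡⟨ ∑-single n _ j (dummies-cancel₂ c₁) ⟩
    value c₁ (top j) + value c₁ (bottom j)
      ≡⟨ cong₂ _+_ (value-in-column c₁ (top j) j refl refl) (value-in-column c₁ (bottom j) j refl refl) ⟩
    colValue c₁ (top j) j * R + colValue c₁ (bottom j) j * R
      ≡⟨ *-distribʳ-+ R (colValue c₁ (top j) j) (colValue c₁ (bottom j) j) ⟨
    (colValue c₁ (top j) j + colValue c₁ (bottom j) j) * R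
      ≡⟨ cong (_* R) (pair-in-column₁ c₁) ⟩
    (𝟙 ⌊ xN j Bool.≟ xS j ⌋ * dummySign c₁) * R
      ≡⟨ xy∙z≈xz∙y *-commutativeSemigroup (𝟙 ⌊ xN j Bool.≟ xS j ⌋) (dummySign c₁) R ⟩
    weightAt j * dummySign c₁ ∎
    where
    open ≡-Reasoning
    j = col c₁
    R = ∏ n (omit j unmarked)

  sum-with-dummies₁ : ∀ t → ∑ n (λ j → value (top j) (inj₁ t) + value (bottom j) (inj₁ t))
                          ≡ weightAt (col (inj₁ t)) * sign (toℕ u <ᵇ toℕ (proj₁ (lookup A t)))
  sum-with-dummies₁ t = begin
    ∑ n (λ j → value (top j) (inj₁ t) + value (bottom j) (inj₁ t))
      ≡⟨ ∑-single n _ j (dummies-cancel₁ t) ⟩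
    value (top j) (inj₁ t) + value (bottom j) (inj₁ t)
      ≡⟨ cong₂ _+_ (value-in-column (top j) (inj₁ t) j refl refl) (value-in-column (bottom j) (inj₁ t) j refl refl) ⟩
    colValue (top j) (inj₁ t) j * R + colValue (bottom j) (inj₁ t) j * R
      ≡⟨ *-distribʳ-+ R (colValue (top j) (inj₁ t) j) (colValue (bottom j) (inj₁ t) j) ⟨
    (colValue (top j) (inj₁ t) j + colValue (bottom j) (inj₁ t) j) * R
      ≡⟨ cong (_* R) (pair-in-column₂ t) ⟩
    (𝟙 ⌊ xN j Bool.≟ xS j ⌋ * s) * R
      ≡⟨ xy∙z≈xz∙y *-commutativeSemigroup (𝟙 ⌊ xN j Bool.≟ xS j ⌋) s R ⟩
    weightAt j * s ∎
    where
    open ≡-Reasoning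
    j = col (inj₁ t)
    R = ∏ n (omit j unmarked)
    s = sign (toℕ u <ᵇ toℕ (proj₁ (lookup A t)))

  option-sum : ∀ (f : Option → ℤ) → ∑ˢ apexInc f ≡ ∑ L (f ∘ inj₁) + ∑ n (λ j → f (top j) + f (bottom j))
  option-sum f = trans (∑ˢ-⊎ (finˢ L) (finˢ 2 ×ˢ finˢ n) f)
    (cong (_+_ (∑ L (f ∘ inj₁))) (trans (∑ˢ-× (finˢ 2) (finˢ n) (f ∘ inj₂))
      (trans (cong (_+_ (∑ n (f ∘ top))) (+-identityʳ (∑ n (f ∘ bottom)))) (sym (∑-distrib-+ n (f ∘ top) (f ∘ bottom))))))

  rowA : Fin L → ℕ
  rowA t = toℕ (proj₁ (lookup A t))

  cellPairs : ℤ
  cellPairs = ∑ L (λ t₁ → ∑ L (λ t₂ → value (inj₁ t₁) (inj₁ t₂)))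

  dummyPairs : Option → ℤ
  dummyPairs c = weightAt (col c) * dummySign c

  excess : ℤ
  excess = ∑ L (dummyPairs ∘ inj₁)
         + (∑ L (λ t → weightAt (col (inj₁ t)) * sign (toℕ u <ᵇ rowA t)) + ∑ n (λ j → dummyPairs (top j) + dummyPairs (bottom j)))

  ∑value≡cellPairs+excess : ∑ˢ (apexInc ×ˢ apexInc) (λ (c₁ , c₂) → value c₁ c₂) ≡ cellPairs + excess
  ∑value≡cellPairs+excess = begin
    ∑ˢ (apexInc ×ˢ apexInc) (λ (c₁ , c₂) → value c₁ c₂)
      ≡⟨ ∑ˢ-× apexInc apexInc (λ (c₁ , c₂) → value c₁ c₂) ⟩
    ∑ˢ apexInc (λ c₁ → ∑ˢ apexInc (value c₁))
      ≡⟨ ∑ˢ-cong apexInc (λ c₁ → trans (option-sum (value c₁)) (cong (_+_ (∑ L (value c₁ ∘ inj₁))) (sum-with-dummies₂ c₁))) ⟩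
    ∑ˢ apexInc (λ c₁ → ∑ L (value c₁ ∘ inj₁) + dummyPairs c₁)
      ≡⟨ option-sum (λ c₁ → ∑ L (value c₁ ∘ inj₁) + dummyPairs c₁) ⟩
    ∑ L (λ t → ∑ L (value (inj₁ t) ∘ inj₁) + dummyPairs (inj₁ t))
      + ∑ n (λ j → (∑ L (value (top j) ∘ inj₁) + dummyPairs (top j)) + (∑ L (value (bottom j) ∘ inj₁) + dummyPairs (bottom j)))
      ≡⟨ cong₂ _+_ (∑-distrib-+ L (λ t → ∑ L (value (inj₁ t) ∘ inj₁)) (dummyPairs ∘ inj₁))
                   (trans (∑-cong n (λ j → interchange +-commutativeSemigroup (∑ L (value (top j) ∘ inj₁)) (dummyPairs (top j))
                                                                              (∑ L (value (bottom j) ∘ inj₁)) (dummyPairs (bottom j))))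
                          (∑-distrib-+ n (λ j → ∑ L (value (top j) ∘ inj₁) + ∑ L (value (bottom j) ∘ inj₁))
                                         (λ j → dummyPairs (top j) + dummyPairs (bottom j)))) ⟩
    (cellPairs + ∑ L (dummyPairs ∘ inj₁))
      + (∑ n (λ j → ∑ L (value (top j) ∘ inj₁) + ∑ L (value (bottom j) ∘ inj₁)) + ∑ n (λ j → dummyPairs (top j) + dummyPairs (bottom j)))
      ≡⟨ cong (λ z → (cellPairs + ∑ L (dummyPairs ∘ inj₁)) + (z + ∑ n (λ j → dummyPairs (top j) + dummyPairs (bottom j)))) dummies-first ⟩
    (cellPairs + ∑ L (dummyPairs ∘ inj₁))
      + (∑ L (λ t → weightAt (col (inj₁ t)) * sign (toℕ u <ᵇ rowA t)) + ∑ n (λ j → dummyPairs (top j) + dummyPairs (bottom j)))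
      ≡⟨ +-assoc cellPairs (∑ L (dummyPairs ∘ inj₁)) _ ⟩
    cellPairs + excess ∎
    where
    open ≡-Reasoning
    dummies-first : ∑ n (λ j → ∑ L (value (top j) ∘ inj₁) + ∑ L (value (bottom j) ∘ inj₁))
                  ≡ ∑ L (λ t → weightAt (col (inj₁ t)) * sign (toℕ u <ᵇ rowA t))
    dummies-first = trans (∑-cong n (λ j → sym (∑-distrib-+ L (value (top j) ∘ inj₁) (value (bottom j) ∘ inj₁))))
                   (trans (∑-comm n L (λ j t → value (top j) (inj₁ t) + value (bottom j) (inj₁ t)))
                          (∑-cong L sum-with-dummies₁))

  module ΓE  = G.Evaluation u xW≗u east≡west
  module Γ↑E = G↑.Evaluation u xW≗u east≡west

  ∑Γvalue≡cellPairs : ∑ˢ (finˢ L ×ˢ finˢ L) ΓE.value ≡ cellPairs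
  ∑Γvalue≡cellPairs = trans (∑ˢ-× (finˢ L) (finˢ L) ΓE.value)
    (∑-cong L λ t₁ → ∑-cong L λ t₂ → ∏-cong n λ j → sym (trans
      (cong₂ (λ a b → column (xN j) (xS j) a b h (suc (suc n)))
             (markerAt-suc (rowA t₁) (proj₂ (lookup A t₁)) j) (markerAt-suc (rowA t₂) (proj₂ (lookup A t₂)) j))
      (column-pad n (xN j) (xS j) (G.marker t₁ j) (G.marker t₂ j) (toℕ u)
                  (markerAt-within (proj₂ (lookup A t₁)) j (toℕ<ᵇn (proj₁ (lookup A t₁))))
                  (markerAt-within (proj₂ (lookup A t₂)) j (toℕ<ᵇn (proj₁ (lookup A t₂)))) u<n)))

  Sig-difference : Sig (Γ↑ n A) G.x - Sig (Γ n A) G.x ≡ excess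
  Sig-difference = begin
    Sig (Γ↑ n A) G.x - Sig (Γ n A) G.x
      ≡⟨ cong₂ _-_ (trans Γ↑E.Sig≡∑value ∑value≡cellPairs+excess) (trans ΓE.Sig≡∑value ∑Γvalue≡cellPairs) ⟩
    (cellPairs + excess) - cellPairs
      ≡⟨ cong (_- cellPairs) (+-comm cellPairs excess) ⟩
    (excess + cellPairs) - cellPairs
      ≡⟨ +-assoc excess cellPairs (- cellPairs) ⟩
    excess + (cellPairs - cellPairs)
      ≡⟨ cong (_+_ excess) (+-inverseʳ cellPairs) ⟩
    excess + + 0
      ≡⟨ +-identityʳ excess ⟩
    excess ∎
    where open ≡-Reasoning

  unmarked≡ : ∀ k → unmarked k ≡ 𝟙 ⌊ xN k Bool.≟ xS k ⌋ * sign (xN k)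
  unmarked≡ k = trans (column-unmarked (suc (suc n)) (xN k) (xS k) h)
    (cong (λ b → 𝟙 ⌊ xN k Bool.≟ xS k ⌋ * sign (b ∧ xN k)) u<suc-n)

  weightAt≡0 : ¬ (∀ j → xN j ≡ xS j) → ∀ j → weightAt j ≡ + 0
  weightAt≡0 ¬agree j with weightAt j ℤ.≟ + 0
  ... | yes w≡0 = w≡0
  ... | no  w≢0 = contradiction agree ¬agree
    where
    others≢0 : ∏ n (omit j unmarked) ≢ + 0
    others≢0 R≡0 = w≢0 (trans (cong (𝟙 ⌊ xN j Bool.≟ xS j ⌋ *_) R≡0) (*-zeroʳ (𝟙 ⌊ xN j Bool.≟ xS j ⌋)))
    agree : ∀ k → xN k ≡ xS k
    agree k with k ≟ j
    ... | yes refl = ⌊⌋-true⇒ (xN k Bool.≟ xS k) (𝟙*≢0 _ _ w≢0)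
    ... | no  k≢j  = ⌊⌋-true⇒ (xN k Bool.≟ xS k) (𝟙*≢0 _ (sign (xN k)) λ e →
                       others≢0 (∏-zero n (omit j unmarked) k (trans (omit-elsewhere unmarked k≢j) (trans (unmarked≡ k) e))))

  excess≡0 : ¬ (∀ j → xN j ≡ xS j) → excess ≡ + 0
  excess≡0 ¬agree = cong₂ _+_ (∑-zero L (λ t → vanish (col (inj₁ t)) _))
                              (cong₂ _+_ (∑-zero L (λ t → vanish (col (inj₁ t)) _))
                                         (∑-zero n (λ j → cong₂ _+_ (vanish j -[1+ 0 ]) (vanish j (+ 0)))))
    where
    vanish : ∀ j s → weightAt j * s ≡ + 0
    vanish j s = cong (_* s) (weightAt≡0 ¬agree j)

  module Propagating (v : Fin n) (xN≗v : xN ≗ unit v) (xS≗xN : ∀ j → xS j ≡ xN j) where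
    unit-here : unit v v ≡ true
    unit-here = ⌊⌋-yes (v ≟ v) refl

    unit-elsewhere : ∀ {k} → k ≢ v → unit v k ≡ false
    unit-elsewhere {k} k≢v = ⌊⌋-no (k ≟ v) k≢v

    unmarked≡sign : ∀ k → unmarked k ≡ sign (unit v k)
    unmarked≡sign k = trans (unmarked≡ k)
      (trans (cong₂ (λ a b → 𝟙 ⌊ a Bool.≟ b ⌋ * sign a) (xN≗v k) (trans (xS≗xN k) (xN≗v k))) (agreeing (unit v k)))
      where
      agreeing : ∀ b → 𝟙 ⌊ b Bool.≟ b ⌋ * sign b ≡ sign b
      agreeing true  = refl
      agreeing false = refl

    omit-unmarked-elsewhere : ∀ j k → k ≢ v → omit j unmarked k ≡ + 1
    omit-unmarked-elsewhere j k k≢v with k ≟ j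
    ... | yes _ = refl
    ... | no  _ = trans (unmarked≡sign k) (cong sign (unit-elsewhere k≢v))

    weightAt≡sign : ∀ j → weightAt j ≡ sign (not (unit v j))
    weightAt≡sign j = trans (cong (_* ∏ n (omit j unmarked)) (cong 𝟙 (⌊⌋-yes (xN j Bool.≟ xS j) (sym (xS≗xN j)))))
                     (trans (*-identityˡ _) (others (j ≟ v)))
      where
      others : Dec (j ≡ v) → ∏ n (omit j unmarked) ≡ sign (not (unit v j))
      others (yes refl) = trans (∏-one n λ k → by-cases k (k ≟ v)) (cong (sign ∘ not) (sym unit-here))
        where
        by-cases : ∀ k → Dec (k ≡ v) → omit v unmarked k ≡ + 1
        by-cases k (yes refl) = omit-here v unmarked
        by-cases k (no k≢v)   = omit-unmarked-elsewhere v k k≢v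
      others (no j≢v) = trans (∏-single n (omit j unmarked) v (omit-unmarked-elsewhere j))
        (trans (omit-elsewhere unmarked (j≢v ∘ sym))
        (trans (unmarked≡sign v) (trans (cong sign unit-here) (cong (sign ∘ not) (sym (unit-elsewhere j≢v))))))

    inA : Fin n → Bool
    inA j = ⌊ (u , j) ∈? A ⌋

    cell-contribution : ∑ L (dummyPairs ∘ inj₁) + ∑ L (λ t → weightAt (col (inj₁ t)) * sign (toℕ u <ᵇ rowA t))
                      ≡ -[1+ 1 ] * + hw inA + + 4 * 𝟙 (inA v)
    cell-contribution = begin
      ∑ L (dummyPairs ∘ inj₁) + ∑ L (λ t → weightAt (col (inj₁ t)) * sign (toℕ u <ᵇ rowA t))
        ≡⟨ ∑-distrib-+ L (dummyPairs ∘ inj₁) (λ t → weightAt (col (inj₁ t)) * sign (toℕ u <ᵇ rowA t)) ⟨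
      ∑ L (λ t → dummyPairs (inj₁ t) + weightAt (col (inj₁ t)) * sign (toℕ u <ᵇ rowA t))
        ≡⟨ ∑-cong L (λ t → trans (sym (*-distribˡ-+ (weightAt (col (inj₁ t))) _ _))
                                 (cong₂ _*_ (weightAt≡sign _) (trans (sign-sum (rowA t) (toℕ u))
                                   (cong (λ b → if b then + 2 else + 0) (marks-toℕ (proj₁ (lookup A t)) u))))) ⟩
      ∑ L (g ∘ lookup A)
        ≡⟨ ∑-lookup A A-unique g ⟩
      ∑ n (λ i → ∑ n (λ j → 𝟙 ⌊ (i , j) ∈? A ⌋ * g (i , j)))
        ≡⟨ ∑-single n (λ i → ∑ n (λ j → 𝟙 ⌊ (i , j) ∈? A ⌋ * g (i , j))) u (λ i i≢u → ∑-zero n (λ j → off-row i j i≢u)) ⟩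
      ∑ n (λ j → 𝟙 (inA j) * g (u , j))
        ≡⟨ ∑-cong n (λ j → cong (λ b → 𝟙 (inA j) * (sign (not (unit v j)) * (if b then + 2 else + 0))) (⌊⌋-yes (u ≟ u) refl)) ⟩
      ∑ n (λ j → 𝟙 (inA j) * (sign (not (unit v j)) * + 2))
        ≡⟨ ∑-cong n (λ j → split-sign (inA j) (unit v j)) ⟩
      ∑ n (λ j → -[1+ 1 ] * 𝟙 (inA j) + (if unit v j then + 4 * 𝟙 (inA j) else + 0))
        ≡⟨ ∑-distrib-+ n (λ j → -[1+ 1 ] * 𝟙 (inA j)) four ⟩
      ∑ n (λ j → -[1+ 1 ] * 𝟙 (inA j)) + ∑ n (λ j → if unit v j then + 4 * 𝟙 (inA j) else + 0)
        ≡⟨ cong₂ _+_ (trans (∑-*ˡ n -[1+ 1 ] (𝟙 ∘ inA)) (cong (-[1+ 1 ] *_) (∑-𝟙≡hw n inA)))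
                     (trans (∑-single n four v (λ j j≢v → cong (λ b → if b then + 4 * 𝟙 (inA j) else + 0) (unit-elsewhere j≢v)))
                            (cong (λ b → if b then + 4 * 𝟙 (inA v) else + 0) unit-here)) ⟩
      -[1+ 1 ] * + hw inA + + 4 * 𝟙 (inA v) ∎
      where
      open ≡-Reasoning
      four : Fin n → ℤ
      four j = if unit v j then + 4 * 𝟙 (inA j) else + 0
      g : Fin n × Fin n → ℤ
      g (i , j) = sign (not (unit v j)) * (if unit i u then + 2 else + 0)
      off-row : ∀ i j → i ≢ u → 𝟙 ⌊ (i , j) ∈? A ⌋ * g (i , j) ≡ + 0
      off-row i j i≢u = trans (cong (λ b → 𝟙 ⌊ (i , j) ∈? A ⌋ * (sign (not (unit v j)) * (if b then + 2 else + 0)))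
                                    (⌊⌋-no (u ≟ i) (i≢u ∘ sym)))
                              (trans (cong (𝟙 ⌊ (i , j) ∈? A ⌋ *_) (*-zeroʳ (sign (not (unit v j)))))
                                     (*-zeroʳ (𝟙 ⌊ (i , j) ∈? A ⌋)))
      split-sign : ∀ b c → 𝟙 b * (sign (not c) * + 2) ≡ -[1+ 1 ] * 𝟙 b + (if c then + 4 * 𝟙 b else + 0)
      split-sign true  true  = refl
      split-sign true  false = refl
      split-sign false true  = refl
      split-sign false false = refl

    dummy-contribution : ∑ n (λ j → dummyPairs (top j) + dummyPairs (bottom j)) ≡ + n * + 1 + -[1+ 1 ]
    dummy-contribution = begin
      ∑ n (λ j → weightAt j * -[1+ 0 ] + weightAt j * + 0)
        ≡⟨ ∑-cong n (λ j → trans (cong (λ w → w * -[1+ 0 ] + w * + 0) (weightAt≡sign j)) (split (unit v j))) ⟩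
      ∑ n (λ j → + 1 + (if unit v j then -[1+ 1 ] else + 0))
        ≡⟨ ∑-distrib-+ n (λ _ → + 1) twice ⟩
      ∑ n (λ _ → + 1) + ∑ n (λ j → if unit v j then -[1+ 1 ] else + 0)
        ≡⟨ cong₂ _+_ (∑-const n (+ 1))
                     (trans (∑-single n twice v (λ j j≢v → cong (λ b → if b then -[1+ 1 ] else + 0) (unit-elsewhere j≢v)))
                            (cong (λ b → if b then -[1+ 1 ] else + 0) unit-here)) ⟩
      + n * + 1 + -[1+ 1 ] ∎
      where
      open ≡-Reasoning
      twice : Fin n → ℤ
      twice j = if unit v j then -[1+ 1 ] else + 0
      split : ∀ c → sign (not c) * -[1+ 0 ] + sign (not c) * + 0 ≡ + 1 + (if c then -[1+ 1 ] else + 0)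
      split true  = refl
      split false = refl

    excess≡ : excess ≡ excessValue n (hw inA) (inA v)
    excess≡ = trans (sym (+-assoc (∑ L (dummyPairs ∘ inj₁)) _ _)) (cong₂ _+_ cell-contribution dummy-contribution)

ΔSig : ∀ {n} → Pairs n → (xN xE xS xW : Fin n → Bool) → ℤ
ΔSig {n} A xN xE xS xW = Sig (Γ↑ n A) (assemble xN xE xS xW) - Sig (Γ n A) (assemble xN xE xS xW)

ΔSig≡0 : ∀ {m} (A : Pairs (suc m)) → Unique A → ∀ xN xE xS xW → hw xW ≡ 1 → ¬ φprop xN xE xS xW →
         ΔSig A xN xE xS xW ≡ + 0
ΔSig≡0 A A-unique xN xE xS xW xW-one ¬prop with all? (λ i → xE i Bool.≟ xW i)
... | no ¬east≡west
  rewrite GammaUpWeights.Sig≡0 A A-unique xN xE xS xW ¬east≡west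
        | GammaWeights.Sig≡0 A A-unique xN xE xS xW ¬east≡west = refl
... | yes east≡west = trans D.Sig-difference (D.excess≡0 λ N≗S → ¬prop (N≗S , sym ∘ east≡west))
  where
  u = proj₁ (hw≡1⇒unit xW xW-one)
  module D = Difference A A-unique xN xE xS xW u (proj₂ (hw≡1⇒unit xW xW-one)) east≡west

ΔSig≡excessValue : ∀ {m} (A : Pairs (suc m)) → Unique A → ∀ xN xE xS xW → φprop xN xE xS xW →
                   ∀ u v → xW ≗ unit u → xN ≗ unit v →
                   ΔSig A xN xE xS xW ≡ excessValue (suc m) (hw (λ j → ⌊ (u , j) ∈? A ⌋)) ⌊ (u , v) ∈? A ⌋
ΔSig≡excessValue A A-unique xN xE xS xW (N≗S , W≗E) u v xW≗u xN≗v = trans D.Sig-difference P.excess≡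
  where
  module D = Difference A A-unique xN xE xS xW u xW≗u (sym ∘ W≗E)
  module P = D.Propagating v xN≗v (sym ∘ N≗S)

lemma37 : (n T : ℕ) (A : Pairs n) → Unique A
    → (∀ (u : Fin n) → hw (λ v → ⌊ (u , v) ∈? A ⌋) ≡ T)
    → (xN xE xS xW : Fin n → Bool) → φone xN xE xS xW
    → (¬ φprop xN xE xS xW
         → Sig (Γ↑ n A) (assemble xN xE xS xW) - Sig (Γ n A) (assemble xN xE xS xW) ≡ + 0)
      × (φprop xN xE xS xW → (u v : Fin n) → xW ≗ unit u → xN ≗ unit v
         → ((u , v) ∉ A
             → Sig (Γ↑ n A) (assemble xN xE xS xW) - Sig (Γ n A) (assemble xN xE xS xW)
               ≡ + n - + (2 ℕ.* T) - + 2)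
         × ((u , v) ∈ A
             → Sig (Γ↑ n A) (assemble xN xE xS xW) - Sig (Γ n A) (assemble xN xE xS xW)
               ≡ + n - + (2 ℕ.* T) + + 2))
lemma37 zero    T A A-unique rows-T xN xE xS xW (() , _)
lemma37 (suc m) T A A-unique rows-T xN xE xS xW (_ , xW-one) =
    ΔSig≡0 A A-unique xN xE xS xW xW-one
  , λ prop u v xW≗u xN≗v →
      let Δ≡ = trans (ΔSig≡excessValue A A-unique xN xE xS xW prop u v xW≗u xN≗v)
                     (cong (λ t → excessValue (suc m) t ⌊ (u , v) ∈? A ⌋) (rows-T u))
      in (λ uv∉A → trans Δ≡ (trans (cong (excessValue (suc m) T) (⌊⌋-no ((u , v) ∈? A) uv∉A)) (excessValue-∉ (suc m) T)))
       , (λ uv∈A → trans Δ≡ (trans (cong (excessValue (suc m) T) (⌊⌋-yes ((u , v) ∈? A) uv∈A)) (excessValue-∈ (suc m) T)))
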